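{- Let $x\in\mathbb{C}$ and let $\mathcal{B}_x$ be the arithmetic function $\mathcal{B}_x(k):=B_k(x)$. For $n\in\mathbb{N}$, let $\mathcal{B}_x^{ -n}$ denote the inverse, with respect to the Cauchy-type product $\bullet$, of the $n$-fold product $\mathcal{B}_x\bullet\cdots\bullet\mathcal{B}_x$. Then for every $n\in\mathbb{N}$ and every $k\in\mathbb{N}_0$, $$\mathcal{B}_x^{ -n}(k)=\frac{k!}{(k+n)!}\sum_{j=0}^{n}\binom{n}{j}(-1)^{n-j}(j-nx)^{k+n}.$$ In addition, $\mathcal{B}_{1-x}^{ -n}(k)=(-1)^{k}\mathcal{B}_{x}^{ -n}(k)$ for all $k\in\mathbb{N}_0$, and $\frac{d}{dx}\mathcal{B}_x^{ -n}(k)=-nk\,\mathcal{B}_x^{ -n}(k-1)$ for all $k\in\mathbb{N}$.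
   Context: An arithmetic function is a map $\mathbb{N}_0\to\mathbb{C}$, where $\mathbb{N}_0$ is the set of nonnegative integers. The Cauchy-type product of arithmetic functions $f,g$ is $(f\bullet g)(k):=\sum_{m=0}^{k}\binom{k}{m}f(m)g(k-m)$; it is commutative and associative with identity $e$, where $e(0)=1$ and $e(k)=0$ for $k>0$, and $f$ is invertible under $\bullet$ if and only if $f(0)\neq 0$. The Bernoulli polynomials $B_k(x)$ are defined by $\frac{te^{xt}}{e^t-1}=\sum_{k=0}^\infty B_k(x)\frac{t^k}{k!}$; in particular $B_0(x)=1$, so $\mathcal{B}_x$ is invertible. -}

module Defs where

open import Data.Nat using (ℕ; zero; suc; _∸_; _!) renaming (_+_ to _+ℕ_; _*_ to _*ℕ_)
open import Data.Nat.Properties using (_!≢0)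
open import Data.Nat.Combinatorics using (_C_)
open import Data.Integer using (+_)
open import Data.Rational using (ℚ; 0ℚ; 1ℚ; _+_; _*_; -_; _/_)
open import Data.List using (List; []; _∷_; map; _++_)
open import Relation.Binary.PropositionalEquality using (_≡_)

ℕ→ℚ : ℕ → ℚ
ℕ→ℚ n = + n / 1

sgn : ℕ → ℚ
sgn zero    = 1ℚ
sgn (suc n) = - sgn n

-- Polynomials in one variable x with rational coefficients,
-- as coefficient lists (constant term first).

Poly : Set
Poly = List ℚ

coeff : Poly → ℕ → ℚ
coeff []      _       = 0ℚ
coeff (a ∷ p) zero    = a
coeff (a ∷ p) (suc i) = coeff p i

infix 4 _≈ₚ_
_≈ₚ_ : Poly → Poly → Set
p ≈ₚ q = ∀ i → coeff p i ≡ coeff q i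

infixl 6 _+ₚ_ _-ₚ_
infixl 7 _*ₚ_

_+ₚ_ : Poly → Poly → Poly
[]      +ₚ q       = q
(a ∷ p) +ₚ []      = a ∷ p
(a ∷ p) +ₚ (b ∷ q) = (a + b) ∷ (p +ₚ q)

scale : ℚ → Poly → Poly
scale c p = map (c *_) p

negₚ : Poly → Poly
negₚ p = scale (- 1ℚ) p

_-ₚ_ : Poly → Poly → Poly
p -ₚ q = p +ₚ negₚ q

_*ₚ_ : Poly → Poly → Poly
[]      *ₚ q = []
(a ∷ p) *ₚ q = scale a q +ₚ (0ℚ ∷ (p *ₚ q))

constₚ : ℚ → Poly
constₚ a = a ∷ []

zeroₚ : Poly
zeroₚ = []

oneₚ : Poly
oneₚ = constₚ 1ℚ

Xₚ : Poly
Xₚ = 0ℚ ∷ 1ℚ ∷ []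

_^ₚ_ : Poly → ℕ → Poly
p ^ₚ zero  = oneₚ
p ^ₚ suc n = p *ₚ (p ^ₚ n)

compₚ : Poly → Poly → Poly
compₚ []      q = []
compₚ (a ∷ p) q = constₚ a +ₚ (q *ₚ compₚ p q)

derivFrom : ℕ → Poly → Poly
derivFrom i []      = []
derivFrom i (b ∷ r) = (ℕ→ℚ i * b) ∷ derivFrom (suc i) r

derivₚ : Poly → Poly
derivₚ []      = []
derivₚ (a ∷ p) = derivFrom 1 p

sumTo : (ℕ → Poly) → ℕ → Poly
sumTo f zero    = f zero
sumTo f (suc k) = sumTo f k +ₚ f (suc k)

AF : Set
AF = ℕ → Poly

infixl 7 _•_
_•_ : AF → AF → AF
(f • g) k = sumTo (λ m → scale (ℕ→ℚ (k C m)) (f m *ₚ g (k ∸ m))) k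

eAF : AF
eAF zero    = oneₚ
eAF (suc k) = zeroₚ

powAF : AF → ℕ → AF
powAF f zero    = eAF
powAF f (suc n) = f • powAF f n

-- g is a (two-sided; • is commutative) inverse of f under •
IsInverse : AF → AF → Set
IsInverse f g = ∀ k → (f • g) k ≈ₚ eAF k

-- Bernoulli polynomials, from  t e^{xt}/(e^t - 1) = Σ B_k(x) t^k/k!.
-- Comparing coefficients of t^{m+1}/(m+1)! in
-- (e^t - 1) Σ B_k(x) t^k/k! = t e^{xt} gives
--   Σ_{j=0}^{m} C(m+1,j) B_j(x) = (m+1) x^m,
-- i.e. B_m(x) = x^m - (1/(m+1)) Σ_{j<m} C(m+1,j) B_j(x).

sumIdx : (ℕ → Poly → Poly) → ℕ → List Poly → Poly
sumIdx f i []       = []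
sumIdx f i (p ∷ ps) = f i p +ₚ sumIdx f (suc i) ps

-- bernList k = [B_0(x), ..., B_k(x)]
bernList : ℕ → List Poly
bernList zero    = oneₚ ∷ []
bernList (suc k) =
  bernList k ++
    ((Xₚ ^ₚ suc k) -ₚ
      scale (+ 1 / suc (suc k))
        (sumIdx (λ j p → scale (ℕ→ℚ (suc (suc k) C j)) p) 0 (bernList k)))
    ∷ []

nthₚ : List Poly → ℕ → Poly
nthₚ []       _       = []
nthₚ (p ∷ ps) zero    = p
nthₚ (p ∷ ps) (suc i) = nthₚ ps i

bernoulli : ℕ → Poly
bernoulli k = nthₚ (bernList k) k

𝓑 : AF
𝓑 k = bernoulli k

𝓑₁₋ : AF
𝓑₁₋ k = compₚ (bernoulli k) (oneₚ -ₚ Xₚ)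

invFormula : ℕ → ℕ → Poly
invFormula n k =
  scale ((+ (k !) / ((k +ℕ n) !)) {{(k +ℕ n) !≢0}})
    (sumTo (λ j → scale (ℕ→ℚ (n C j) * sgn (n ∸ j))
                        ((constₚ (ℕ→ℚ j) -ₚ scale (ℕ→ℚ n) Xₚ) ^ₚ (k +ℕ n)))
           n)

-- The binomial convolution  (f • g)(k) = Σ C(k,m) f(m) g(k-m)  is the product of
-- exponential generating functions  F(t) = Σ f(k) tᵏ/k!.  We make this dictionary
-- precise inside the ring of arithmetic functions (values in ℚ[x]):
--   * the shift  ∂f(k) = f(k+1)  (d/dt) obeys the Leibniz rule for •, and every ring
--     law of • follows by induction on k through it;
--   * Eₐ(k) = aᵏ plays e^{at}, with  Eₐ • E_b = E_{a+b};
--   * τ, multiplication by t, satisfies  τ(f • g) = τf • g, and D(k) = 1/(k+1) plays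
--     (eᵗ-1)/t, so  τD = E₁ - e.
-- The recurrence defining B_k(x) says  𝓑 • (E₁ - e) = τEₓ,  i.e.  D • 𝓑 = Eₓ.  Hence
-- P = D • E₋ₓ  inverts 𝓑, Pⁿ inverts 𝓑ⁿ, and inverses are unique.  Then
--   * formula:   τⁿPⁿ = (τP)ⁿ = (E_{1-x} - E₋ₓ)ⁿ; expanding by the binomial theorem
--                and reading off the coefficient of index k+n gives invFormula;
--   * symmetry:  the sign twist f(k) ↦ (-1)ᵏf(k) and the substitution x ↦ 1-x are
--                ring endomorphisms; applied to D • 𝓑 = Eₓ they give
--                D • σ𝓑 = E_{1-x} = D • 𝓑_{1-x}, and D is invertible, so 𝓑_{1-x} = σ𝓑
--                and the inverses are related by σ as well;
--   * derivative: d/dx is a derivation of (AF, •) with  dP = -τP, so  dPⁿ = -n τPⁿ.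
module Submission where

open import Defs
open import Data.Nat using (ℕ; zero; suc; NonZero; _≤_; z≤n; _∸_; _!)
  renaming (_+_ to _+ℕ_; _*_ to _*ℕ_)
import Data.Nat.Properties as ℕP
open import Data.Nat.Combinatorics
  using (_C_; nCk+nC[k+1]≡[n+1]C[k+1]; k>n⇒nCk≡0; nCk≡nC[n∸k]; nC1≡n)
open import Data.Integer as ℤ using (+_)
import Data.Integer.Properties as ℤP
open import Data.Rational using (ℚ; 0ℚ; 1ℚ; _+_; _*_; -_; _/_; toℚᵘ)
import Data.Rational.Properties as ℚP
import Data.Rational.Unnormalised as ℚᵘ
import Data.Rational.Unnormalised.Properties as ℚᵘP
open import Data.List using ([]; _∷_; _++_; length)
import Data.List.Properties as ListP
open import Data.Product using (Σ; _×_; _,_)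
open import Data.Maybe using (Maybe; just; nothing)
open import Relation.Nullary using (yes; no)
open import Relation.Binary.PropositionalEquality
  using (_≡_; refl; sym; trans; cong; cong₂; module ≡-Reasoning)
import Relation.Binary.Reasoning.Setoid as SetoidReasoning
open import Data.Fin using (toℕ)
open import Algebra.Bundles using (CommutativeRing; CommutativeSemiring)
import Algebra.Definitions.RawMonoid as RawMonoidDefinitions
import Algebra.Properties.Semiring.Exp as SemiringExp
import Algebra.Properties.CommutativeSemiring.Exp as CommutativeSemiringExp
import Algebra.Properties.CommutativeSemiring.Binomial as Binomial
open import Tactic.RingSolver using (solve-∀)
open import Tactic.RingSolver.Core.AlmostCommutativeRing using (AlmostCommutativeRing; fromCommutativeRing)

-- The rationals, packaged for the ring solver (with a decidable zero test, so that
-- vanishing constant coefficients are recognised).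
ℚ-ring : AlmostCommutativeRing _ _
ℚ-ring = fromCommutativeRing ℚP.+-*-commutativeRing is-zero
  where
  is-zero : ∀ x → Maybe (0ℚ ≡ x)
  is-zero x with 0ℚ ℚP.≟ x
  ... | yes p = just p
  ... | no _  = nothing

toℚᵘ-/ : ∀ i d → toℚᵘ (i / suc d) ℚᵘ.≃ ℚᵘ.mkℚᵘ i d
toℚᵘ-/ i d = ℚP.toℚᵘ-fromℚᵘ (ℚᵘ.mkℚᵘ i d)

ℕ→ℚ-suc : ∀ n → ℕ→ℚ (suc n) ≡ 1ℚ + ℕ→ℚ n
ℕ→ℚ-suc n = ℚP.toℚᵘ-injective (ℚᵘP.≃-trans (toℚᵘ-/ (+ suc n) 0)
  (ℚᵘP.≃-trans (ℚᵘ.*≡* cross) (ℚᵘP.≃-sym (ℚᵘP.≃-trans (ℚP.toℚᵘ-homo-+ 1ℚ (ℕ→ℚ n))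
    (ℚᵘP.+-cong (toℚᵘ-/ (+ 1) 0) (toℚᵘ-/ (+ n) 0))))))
  where
  cross : (+ suc n) ℤ.* (+ 1) ≡ ((+ 1) ℤ.* (+ 1) ℤ.+ (+ n) ℤ.* (+ 1)) ℤ.* (+ 1)
  cross rewrite ℤP.*-identityʳ (+ suc n) | ℤP.*-identityʳ (+ n)
              | ℤP.*-identityʳ ((+ 1) ℤ.+ (+ n)) = refl

ℕ→ℚ-+ : ∀ m n → ℕ→ℚ (m +ℕ n) ≡ ℕ→ℚ m + ℕ→ℚ n
ℕ→ℚ-+ zero n = sym (ℚP.+-identityˡ (ℕ→ℚ n))
ℕ→ℚ-+ (suc m) n = begin
  ℕ→ℚ (suc (m +ℕ n))     ≡⟨ ℕ→ℚ-suc (m +ℕ n) ⟩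
  1ℚ + ℕ→ℚ (m +ℕ n)      ≡⟨ cong (λ y → 1ℚ + y) (ℕ→ℚ-+ m n) ⟩
  1ℚ + (ℕ→ℚ m + ℕ→ℚ n)   ≡⟨ ℚP.+-assoc 1ℚ (ℕ→ℚ m) (ℕ→ℚ n) ⟨
  (1ℚ + ℕ→ℚ m) + ℕ→ℚ n   ≡⟨ cong (_+ ℕ→ℚ n) (ℕ→ℚ-suc m) ⟨
  ℕ→ℚ (suc m) + ℕ→ℚ n    ∎
  where open ≡-Reasoning

ℕ→ℚ-* : ∀ m n → ℕ→ℚ (m *ℕ n) ≡ ℕ→ℚ m * ℕ→ℚ n
ℕ→ℚ-* zero n = sym (ℚP.*-zeroˡ (ℕ→ℚ n))
ℕ→ℚ-* (suc m) n = begin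
  ℕ→ℚ (n +ℕ m *ℕ n)        ≡⟨ ℕ→ℚ-+ n (m *ℕ n) ⟩
  ℕ→ℚ n + ℕ→ℚ (m *ℕ n)     ≡⟨ cong (λ y → ℕ→ℚ n + y) (ℕ→ℚ-* m n) ⟩
  ℕ→ℚ n + ℕ→ℚ m * ℕ→ℚ n    ≡⟨ factor (ℕ→ℚ n) (ℕ→ℚ m) ⟩
  (1ℚ + ℕ→ℚ m) * ℕ→ℚ n     ≡⟨ cong (_* ℕ→ℚ n) (ℕ→ℚ-suc m) ⟨
  ℕ→ℚ (suc m) * ℕ→ℚ n      ∎
  where
  open ≡-Reasoning
  factor : ∀ a b → a + b * a ≡ (1ℚ + b) * a
  factor = solve-∀ ℚ-ring

recip-inverse : ∀ b .{{_ : NonZero b}} → (+ 1 / b) * ℕ→ℚ b ≡ 1ℚ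
recip-inverse (suc d) = ℚP.toℚᵘ-injective (ℚᵘP.≃-trans (ℚP.toℚᵘ-homo-* (+ 1 / suc d) (ℕ→ℚ (suc d)))
  (ℚᵘP.≃-trans (ℚᵘP.*-cong (toℚᵘ-/ (+ 1) d) (toℚᵘ-/ (+ suc d) 0))
    (ℚᵘP.≃-trans (ℚᵘ.*≡* cross) (ℚᵘP.≃-sym (toℚᵘ-/ (+ 1) 0)))))
  where
  cross : ((+ 1) ℤ.* (+ suc d)) ℤ.* (+ 1) ≡ (+ 1) ℤ.* (+ (suc d *ℕ 1))
  cross = trans (ℤP.*-identityʳ _) (cong ((+ 1) ℤ.*_) (cong +_ (sym (ℕP.*-identityʳ (suc d)))))

fraction-as-product : ∀ a b .{{_ : NonZero b}} → (+ a / b) ≡ ℕ→ℚ a * (+ 1 / b)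
fraction-as-product a (suc d) = ℚP.toℚᵘ-injective (ℚᵘP.≃-trans (toℚᵘ-/ (+ a) d)
  (ℚᵘP.≃-sym (ℚᵘP.≃-trans (ℚP.toℚᵘ-homo-* (ℕ→ℚ a) (+ 1 / suc d))
    (ℚᵘP.≃-trans (ℚᵘP.*-cong (toℚᵘ-/ (+ a) 0) (toℚᵘ-/ (+ 1) d)) (ℚᵘ.*≡* cross)))))
  where
  cross : ((+ a) ℤ.* (+ 1)) ℤ.* (+ suc d) ≡ (+ a) ℤ.* (+ (1 *ℕ suc d))
  cross rewrite ℤP.*-identityʳ (+ a) | ℕP.*-identityˡ (suc d) = refl

-- Polynomials.  Coefficient lists are compared coefficientwise; the record keeps both
-- sides of an equation visible to unification (Defs' _≈ₚ_ unfolds to a Π-type).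

infix 4 _≋_
record _≋_ (p q : Poly) : Set where
  constructor mk≋
  field at : ∀ i → coeff p i ≡ coeff q i
open _≋_

≋-refl : ∀ {p} → p ≋ p
≋-refl = mk≋ λ i → refl

≋-sym : ∀ {p q} → p ≋ q → q ≋ p
≋-sym e = mk≋ λ i → sym (at e i)

≋-trans : ∀ {p q r} → p ≋ q → q ≋ r → p ≋ r
≋-trans e f = mk≋ λ i → trans (at e i) (at f i)

≡⇒≋ : ∀ {p q} → p ≡ q → p ≋ q
≡⇒≋ refl = ≋-refl

tailₚ : Poly → Poly
tailₚ []      = []
tailₚ (a ∷ p) = p

coeff-tail : ∀ p i → coeff (tailₚ p) i ≡ coeff p (suc i)
coeff-tail []      i = refl
coeff-tail (a ∷ p) i = refl

coeff-+ : ∀ p q i → coeff (p +ₚ q) i ≡ coeff p i + coeff q i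
coeff-+ []      q       i       = sym (ℚP.+-identityˡ (coeff q i))
coeff-+ (a ∷ p) []      i       = sym (ℚP.+-identityʳ (coeff (a ∷ p) i))
coeff-+ (a ∷ p) (b ∷ q) zero    = refl
coeff-+ (a ∷ p) (b ∷ q) (suc i) = coeff-+ p q i

coeff-scale : ∀ c p i → coeff (scale c p) i ≡ c * coeff p i
coeff-scale c []      i       = sym (ℚP.*-zeroʳ c)
coeff-scale c (a ∷ p) zero    = refl
coeff-scale c (a ∷ p) (suc i) = coeff-scale c p i

coeff-neg : ∀ p i → coeff (negₚ p) i ≡ - coeff p i
coeff-neg p i = trans (coeff-scale (- 1ℚ) p i) (minus-one (coeff p i))
  where
  minus-one : ∀ a → (- 1ℚ) * a ≡ - a
  minus-one = solve-∀ ℚ-ring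

coeff-*-zero : ∀ p q → coeff (p *ₚ q) 0 ≡ coeff p 0 * coeff q 0
coeff-*-zero []      q = sym (ℚP.*-zeroˡ (coeff q 0))
coeff-*-zero (a ∷ p) q =
  trans (coeff-+ (scale a q) (0ℚ ∷ (p *ₚ q)) 0) (trans (ℚP.+-identityʳ _) (coeff-scale a q 0))

coeff-*-suc : ∀ p q i →
  coeff (p *ₚ q) (suc i) ≡ coeff p 0 * coeff q (suc i) + coeff (tailₚ p *ₚ q) i
coeff-*-suc []      q i = zero-sum (coeff q (suc i))
  where
  zero-sum : ∀ a → 0ℚ ≡ 0ℚ * a + 0ℚ
  zero-sum = solve-∀ ℚ-ring
coeff-*-suc (a ∷ p) q i =
  trans (coeff-+ (scale a q) (0ℚ ∷ (p *ₚ q)) (suc i))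
        (cong (_+ coeff (p *ₚ q) i) (coeff-scale a q (suc i)))

+ₚ-cong : ∀ {p p' q q'} → p ≋ p' → q ≋ q' → p +ₚ q ≋ p' +ₚ q'
+ₚ-cong {p} {p'} {q} {q'} e f = mk≋ λ i →
  trans (coeff-+ p q i) (trans (cong₂ _+_ (at e i) (at f i)) (sym (coeff-+ p' q' i)))

scale-cong : ∀ {c d p q} → c ≡ d → p ≋ q → scale c p ≋ scale d q
scale-cong {c} {_} {p} {q} refl f = mk≋ λ i →
  trans (coeff-scale c p i) (trans (cong (c *_) (at f i)) (sym (coeff-scale c q i)))

scale-congʳ : ∀ c {p q} → p ≋ q → scale c p ≋ scale c q
scale-congʳ c = scale-cong {c} refl

negₚ-cong : ∀ {p q} → p ≋ q → negₚ p ≋ negₚ q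
negₚ-cong = scale-congʳ (- 1ℚ)

+ₚ-assoc : ∀ p q r → (p +ₚ q) +ₚ r ≋ p +ₚ (q +ₚ r)
+ₚ-assoc p q r = mk≋ λ i → trans (coeff-+ (p +ₚ q) r i)
  (trans (cong (_+ coeff r i) (coeff-+ p q i))
  (trans (ℚP.+-assoc (coeff p i) (coeff q i) (coeff r i))
  (sym (trans (coeff-+ p (q +ₚ r) i) (cong (λ y → coeff p i + y) (coeff-+ q r i))))))

+ₚ-comm : ∀ p q → p +ₚ q ≋ q +ₚ p
+ₚ-comm p q = mk≋ λ i →
  trans (coeff-+ p q i) (trans (ℚP.+-comm (coeff p i) (coeff q i)) (sym (coeff-+ q p i)))

+ₚ-identityʳ : ∀ p → p +ₚ [] ≋ p
+ₚ-identityʳ p = mk≋ λ i → trans (coeff-+ p [] i) (ℚP.+-identityʳ (coeff p i))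

negₚ-inverseˡ : ∀ p → negₚ p +ₚ p ≋ []
negₚ-inverseˡ p = mk≋ λ i → trans (coeff-+ (negₚ p) p i)
  (trans (cong (_+ coeff p i) (coeff-neg p i)) (ℚP.+-inverseˡ (coeff p i)))

negₚ-inverseʳ : ∀ p → p +ₚ negₚ p ≋ []
negₚ-inverseʳ p = ≋-trans (+ₚ-comm p (negₚ p)) (negₚ-inverseˡ p)

tailₚ-cong : ∀ {p q} → p ≋ q → tailₚ p ≋ tailₚ q
tailₚ-cong {p} {q} e = mk≋ λ i → trans (coeff-tail p i) (trans (at e (suc i)) (sym (coeff-tail q i)))

tailₚ-+ : ∀ p q → tailₚ (p +ₚ q) ≋ tailₚ p +ₚ tailₚ q
tailₚ-+ p q = mk≋ λ i → trans (coeff-tail (p +ₚ q) i) (trans (coeff-+ p q (suc i))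
  (sym (trans (coeff-+ (tailₚ p) (tailₚ q) i) (cong₂ _+_ (coeff-tail p i) (coeff-tail q i)))))

tailₚ-scale : ∀ c p → tailₚ (scale c p) ≋ scale c (tailₚ p)
tailₚ-scale c []      = ≋-refl
tailₚ-scale c (a ∷ p) = ≋-refl

tailₚ-* : ∀ p q → tailₚ (p *ₚ q) ≋ scale (coeff p 0) (tailₚ q) +ₚ tailₚ p *ₚ q
tailₚ-* p q = mk≋ λ i → trans (coeff-tail (p *ₚ q) i) (trans (coeff-*-suc p q i)
  (sym (trans (coeff-+ (scale (coeff p 0) (tailₚ q)) (tailₚ p *ₚ q) i)
    (cong (_+ coeff (tailₚ p *ₚ q) i)
      (trans (coeff-scale (coeff p 0) (tailₚ q) i) (cong (coeff p 0 *_) (coeff-tail q i)))))))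

*ₚ-cong-at : ∀ i {p p' q q'} → p ≋ p' → q ≋ q' → coeff (p *ₚ q) i ≡ coeff (p' *ₚ q') i
*ₚ-cong-at zero    {p} {p'} {q} {q'} e f =
  trans (coeff-*-zero p q) (trans (cong₂ _*_ (at e 0) (at f 0)) (sym (coeff-*-zero p' q')))
*ₚ-cong-at (suc i) {p} {p'} {q} {q'} e f = trans (coeff-*-suc p q i)
  (trans (cong₂ _+_ (cong₂ _*_ (at e 0) (at f (suc i))) (*ₚ-cong-at i (tailₚ-cong e) f))
  (sym (coeff-*-suc p' q' i)))

*ₚ-cong : ∀ {p p' q q'} → p ≋ p' → q ≋ q' → p *ₚ q ≋ p' *ₚ q'
*ₚ-cong e f = mk≋ λ i → *ₚ-cong-at i e f

*ₚ-comm-at : ∀ i p q → coeff (p *ₚ q) i ≡ coeff (q *ₚ p) i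
*ₚ-comm-at zero p q =
  trans (coeff-*-zero p q) (trans (ℚP.*-comm (coeff p 0) (coeff q 0)) (sym (coeff-*-zero q p)))
*ₚ-comm-at (suc zero) p q =
  trans (coeff-*-suc p q 0)
  (trans (cong (λ y → coeff p 0 * coeff q 1 + y)
               (trans (coeff-*-zero (tailₚ p) q) (cong (_* coeff q 0) (coeff-tail p 0))))
  (trans (swap (coeff p 0) (coeff q 1) (coeff p 1) (coeff q 0))
  (sym (trans (coeff-*-suc q p 0) (cong (λ y → coeff q 0 * coeff p 1 + y)
               (trans (coeff-*-zero (tailₚ q) p) (cong (_* coeff p 0) (coeff-tail q 0))))))))
  where
  swap : ∀ a b c d → a * b + c * d ≡ d * c + b * a
  swap = solve-∀ ℚ-ring
*ₚ-comm-at (suc (suc j)) p q =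
  trans (coeff-*-suc p q (suc j))
  (trans (cong (λ y → coeff p 0 * coeff q (suc (suc j)) + y)
    (trans (*ₚ-comm-at (suc j) (tailₚ p) q) (trans (coeff-*-suc q (tailₚ p) j)
      (cong₂ (λ x y → coeff q 0 * x + y) (coeff-tail p (suc j)) (*ₚ-comm-at j (tailₚ q) (tailₚ p))))))
  (trans (swap (coeff p 0) (coeff q (suc (suc j))) (coeff q 0) (coeff p (suc (suc j)))
               (coeff (tailₚ p *ₚ tailₚ q) j))
  (sym (trans (coeff-*-suc q p (suc j)) (cong (λ y → coeff q 0 * coeff p (suc (suc j)) + y)
    (trans (*ₚ-comm-at (suc j) (tailₚ q) p) (trans (coeff-*-suc p (tailₚ q) j)
      (cong (λ x → coeff p 0 * x + coeff (tailₚ p *ₚ tailₚ q) j) (coeff-tail q (suc j))))))))))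
  where
  swap : ∀ a b c d e → a * b + (c * d + e) ≡ c * d + (a * b + e)
  swap = solve-∀ ℚ-ring

*ₚ-comm : ∀ p q → p *ₚ q ≋ q *ₚ p
*ₚ-comm p q = mk≋ λ i → *ₚ-comm-at i p q

*ₚ-distribʳ-at : ∀ i p q r → coeff ((p +ₚ q) *ₚ r) i ≡ coeff (p *ₚ r) i + coeff (q *ₚ r) i
*ₚ-distribʳ-at zero p q r = trans (coeff-*-zero (p +ₚ q) r)
  (trans (cong (_* coeff r 0) (coeff-+ p q 0))
  (trans (ℚP.*-distribʳ-+ (coeff r 0) (coeff p 0) (coeff q 0))
         (sym (cong₂ _+_ (coeff-*-zero p r) (coeff-*-zero q r)))))
*ₚ-distribʳ-at (suc i) p q r = trans (coeff-*-suc (p +ₚ q) r i)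
  (trans (cong₂ (λ x y → x * coeff r (suc i) + y) (coeff-+ p q 0)
     (trans (*ₚ-cong-at i (tailₚ-+ p q) (≋-refl {r})) (*ₚ-distribʳ-at i (tailₚ p) (tailₚ q) r)))
  (trans (regroup (coeff p 0) (coeff q 0) (coeff r (suc i)) (coeff (tailₚ p *ₚ r) i) (coeff (tailₚ q *ₚ r) i))
  (sym (cong₂ _+_ (coeff-*-suc p r i) (coeff-*-suc q r i)))))
  where
  regroup : ∀ a b c d e → (a + b) * c + (d + e) ≡ (a * c + d) + (b * c + e)
  regroup = solve-∀ ℚ-ring

*ₚ-distribʳ : ∀ r p q → (p +ₚ q) *ₚ r ≋ p *ₚ r +ₚ q *ₚ r
*ₚ-distribʳ r p q = mk≋ λ i → trans (*ₚ-distribʳ-at i p q r) (sym (coeff-+ (p *ₚ r) (q *ₚ r) i))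

*ₚ-distribˡ : ∀ r p q → r *ₚ (p +ₚ q) ≋ r *ₚ p +ₚ r *ₚ q
*ₚ-distribˡ r p q = ≋-trans (*ₚ-comm r (p +ₚ q))
  (≋-trans (*ₚ-distribʳ r p q) (+ₚ-cong (*ₚ-comm p r) (*ₚ-comm q r)))

scale-*ₚ-at : ∀ i c p q → coeff (scale c p *ₚ q) i ≡ c * coeff (p *ₚ q) i
scale-*ₚ-at zero c p q = trans (coeff-*-zero (scale c p) q)
  (trans (cong (_* coeff q 0) (coeff-scale c p 0))
  (trans (ℚP.*-assoc c (coeff p 0) (coeff q 0)) (cong (c *_) (sym (coeff-*-zero p q)))))
scale-*ₚ-at (suc i) c p q = trans (coeff-*-suc (scale c p) q i)
  (trans (cong₂ (λ x y → x * coeff q (suc i) + y) (coeff-scale c p 0)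
     (trans (*ₚ-cong-at i (tailₚ-scale c p) (≋-refl {q})) (scale-*ₚ-at i c (tailₚ p) q)))
  (trans (factor c (coeff p 0) (coeff q (suc i)) (coeff (tailₚ p *ₚ q) i))
  (cong (c *_) (sym (coeff-*-suc p q i)))))
  where
  factor : ∀ a b c d → (a * b) * c + a * d ≡ a * (b * c + d)
  factor = solve-∀ ℚ-ring

*ₚ-assoc-at : ∀ i p q r → coeff ((p *ₚ q) *ₚ r) i ≡ coeff (p *ₚ (q *ₚ r)) i
*ₚ-assoc-at zero p q r = trans (coeff-*-zero (p *ₚ q) r)
  (trans (cong (_* coeff r 0) (coeff-*-zero p q))
  (trans (ℚP.*-assoc (coeff p 0) (coeff q 0) (coeff r 0))
  (sym (trans (coeff-*-zero p (q *ₚ r)) (cong (coeff p 0 *_) (coeff-*-zero q r))))))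
*ₚ-assoc-at (suc i) p q r = trans (coeff-*-suc (p *ₚ q) r i)
  (trans (cong₂ (λ x y → x * coeff r (suc i) + y) (coeff-*-zero p q)
     (trans (*ₚ-cong-at i (tailₚ-* p q) (≋-refl {r}))
     (trans (*ₚ-distribʳ-at i (scale (coeff p 0) (tailₚ q)) (tailₚ p *ₚ q) r)
       (cong₂ _+_ (scale-*ₚ-at i (coeff p 0) (tailₚ q) r) (*ₚ-assoc-at i (tailₚ p) q r)))))
  (trans (regroup (coeff p 0) (coeff q 0) (coeff r (suc i)) (coeff (tailₚ q *ₚ r) i)
                  (coeff (tailₚ p *ₚ (q *ₚ r)) i))
  (sym (trans (coeff-*-suc p (q *ₚ r) i)
    (cong (λ x → coeff p 0 * x + coeff (tailₚ p *ₚ (q *ₚ r)) i) (coeff-*-suc q r i))))))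
  where
  regroup : ∀ a b c d e → (a * b) * c + (a * d + e) ≡ a * (b * c + d) + e
  regroup = solve-∀ ℚ-ring

*ₚ-assoc : ∀ p q r → (p *ₚ q) *ₚ r ≋ p *ₚ (q *ₚ r)
*ₚ-assoc p q r = mk≋ λ i → *ₚ-assoc-at i p q r

scale-one : ∀ p → scale 1ℚ p ≋ p
scale-one p = mk≋ λ i → trans (coeff-scale 1ℚ p i) (ℚP.*-identityˡ (coeff p i))

*ₚ-identityˡ : ∀ p → oneₚ *ₚ p ≋ p
*ₚ-identityˡ p = ≋-trans (+ₚ-cong (scale-one p) zero-const) (+ₚ-identityʳ p)
  where
  zero-const : 0ℚ ∷ [] ≋ []
  zero-const = mk≋ λ { zero → refl ; (suc i) → refl }

*ₚ-identityʳ : ∀ p → p *ₚ oneₚ ≋ p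
*ₚ-identityʳ p = ≋-trans (*ₚ-comm p oneₚ) (*ₚ-identityˡ p)

-- ℚ[x] is a commutative ring, so the ring solver normalises polynomial identities.
Poly-CR : CommutativeRing _ _
Poly-CR = record
  { Carrier = Poly ; _≈_ = _≋_ ; _+_ = _+ₚ_ ; _*_ = _*ₚ_ ; -_ = negₚ ; 0# = [] ; 1# = oneₚ
  ; isCommutativeRing = record
    { isRing = record
      { +-isAbelianGroup = record
        { isGroup = record
          { isMonoid = record
            { isSemigroup = record
              { isMagma = record
                { isEquivalence = record { refl = ≋-refl ; sym = ≋-sym ; trans = ≋-trans }
                ; ∙-cong = +ₚ-cong }
              ; assoc = +ₚ-assoc }
            ; identity = (λ p → ≋-refl) , +ₚ-identityʳ }
          ; inverse = negₚ-inverseˡ , negₚ-inverseʳ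
          ; ⁻¹-cong = negₚ-cong }
        ; comm = +ₚ-comm }
      ; *-cong = *ₚ-cong
      ; *-assoc = *ₚ-assoc
      ; *-identity = *ₚ-identityˡ , *ₚ-identityʳ
      ; distrib = *ₚ-distribˡ , *ₚ-distribʳ }
    ; *-comm = *ₚ-comm } }

Poly-ring : AlmostCommutativeRing _ _
Poly-ring = fromCommutativeRing Poly-CR (λ _ → nothing)

module ≋-Reasoning = SetoidReasoning (CommutativeRing.setoid Poly-CR)

*ₚ-congˡ : ∀ {p p'} → p ≋ p' → ∀ q → p *ₚ q ≋ p' *ₚ q
*ₚ-congˡ e q = *ₚ-cong e (≋-refl {q})

*ₚ-congʳ : ∀ p {q q'} → q ≋ q' → p *ₚ q ≋ p *ₚ q'
*ₚ-congʳ p e = *ₚ-cong (≋-refl {p}) e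

+ₚ-congˡ : ∀ {p p'} → p ≋ p' → ∀ q → p +ₚ q ≋ p' +ₚ q
+ₚ-congˡ e q = +ₚ-cong e (≋-refl {q})

+ₚ-congʳ : ∀ p {q q'} → q ≋ q' → p +ₚ q ≋ p +ₚ q'
+ₚ-congʳ p e = +ₚ-cong (≋-refl {p}) e

scale-const : ∀ c p → scale c p ≋ constₚ c *ₚ p
scale-const c p = ≋-sym (≋-trans (+ₚ-congʳ (scale c p) zero-tail) (+ₚ-identityʳ (scale c p)))
  where
  zero-tail : 0ℚ ∷ ([] *ₚ p) ≋ []
  zero-tail = mk≋ λ { zero → refl ; (suc i) → refl }

scale-*ₚ : ∀ c p q → scale c p *ₚ q ≋ scale c (p *ₚ q)
scale-*ₚ c p q = mk≋ λ i → trans (scale-*ₚ-at i c p q) (sym (coeff-scale c (p *ₚ q) i))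

*ₚ-scale : ∀ c p q → p *ₚ scale c q ≋ scale c (p *ₚ q)
*ₚ-scale c p q = ≋-trans (*ₚ-comm p (scale c q))
  (≋-trans (scale-*ₚ c q p) (scale-congʳ c (*ₚ-comm q p)))

scale-+ : ∀ a b p → scale (a + b) p ≋ scale a p +ₚ scale b p
scale-+ a b p = mk≋ λ i → trans (coeff-scale (a + b) p i)
  (trans (ℚP.*-distribʳ-+ (coeff p i) a b)
  (sym (trans (coeff-+ (scale a p) (scale b p) i) (cong₂ _+_ (coeff-scale a p i) (coeff-scale b p i)))))

scale-+ₚ : ∀ c p q → scale c (p +ₚ q) ≋ scale c p +ₚ scale c q
scale-+ₚ c p q = mk≋ λ i → trans (coeff-scale c (p +ₚ q) i)
  (trans (cong (c *_) (coeff-+ p q i))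
  (trans (ℚP.*-distribˡ-+ c (coeff p i) (coeff q i))
  (sym (trans (coeff-+ (scale c p) (scale c q) i) (cong₂ _+_ (coeff-scale c p i) (coeff-scale c q i))))))

scale-scale : ∀ a b p → scale a (scale b p) ≋ scale (a * b) p
scale-scale a b p = mk≋ λ i → trans (coeff-scale a (scale b p) i)
  (trans (cong (a *_) (coeff-scale b p i))
  (trans (sym (ℚP.*-assoc a b (coeff p i))) (sym (coeff-scale (a * b) p i))))

scale-zero : ∀ p → scale 0ℚ p ≋ []
scale-zero p = mk≋ λ i → trans (coeff-scale 0ℚ p i) (ℚP.*-zeroˡ (coeff p i))

scale-suc : ∀ k p → scale (ℕ→ℚ (suc k)) p ≋ p +ₚ scale (ℕ→ℚ k) p
scale-suc k p = ≋-trans (scale-cong (ℕ→ℚ-suc k) (≋-refl {p}))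
  (≋-trans (scale-+ 1ℚ (ℕ→ℚ k) p) (+ₚ-congˡ (scale-one p) _))

const-* : ∀ a b → constₚ (a * b) ≋ constₚ a *ₚ constₚ b
const-* a b = ≋-sym (≋-trans (+ₚ-congʳ (scale a (constₚ b)) zero-tail) (+ₚ-identityʳ _))
  where
  zero-tail : 0ℚ ∷ ([] *ₚ constₚ b) ≋ []
  zero-tail = mk≋ λ { zero → refl ; (suc i) → refl }

const-zero : constₚ 0ℚ ≋ []
const-zero = mk≋ λ { zero → refl ; (suc i) → refl }

*ₚ-zeroʳ : ∀ p → p *ₚ [] ≋ []
*ₚ-zeroʳ p = *ₚ-comm p []

sum-cong : ∀ {f g : ℕ → Poly} k → (∀ m → m ≤ k → f m ≋ g m) → sumTo f k ≋ sumTo g k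
sum-cong zero    e = e 0 z≤n
sum-cong (suc k) e = +ₚ-cong (sum-cong k (λ m m≤k → e m (ℕP.m≤n⇒m≤1+n m≤k))) (e (suc k) ℕP.≤-refl)

sum-+ : ∀ (f g : ℕ → Poly) k → sumTo (λ m → f m +ₚ g m) k ≋ sumTo f k +ₚ sumTo g k
sum-+ f g zero    = ≋-refl
sum-+ f g (suc k) = ≋-trans (+ₚ-congˡ (sum-+ f g k) (f (suc k) +ₚ g (suc k)))
  (interchange (sumTo f k) (sumTo g k) (f (suc k)) (g (suc k)))
  where
  interchange : ∀ a b c d → (a +ₚ b) +ₚ (c +ₚ d) ≋ (a +ₚ c) +ₚ (b +ₚ d)
  interchange = solve-∀ Poly-ring

sum-first : ∀ (f : ℕ → Poly) k → sumTo f (suc k) ≋ f 0 +ₚ sumTo (λ m → f (suc m)) k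
sum-first f zero    = ≋-refl
sum-first f (suc k) = ≋-trans (+ₚ-congˡ (sum-first f k) (f (suc (suc k)))) (+ₚ-assoc (f 0) _ _)

sum-last-zero : ∀ (f : ℕ → Poly) k → f (suc k) ≋ [] → sumTo f (suc k) ≋ sumTo f k
sum-last-zero f k e = ≋-trans (+ₚ-congʳ (sumTo f k) e) (+ₚ-identityʳ _)

-- Pascal's rule C(n+1,j+1) = C(n,j) + C(n,j+1), summed: a binomially weighted sum of
-- length n+2 splits into a shifted and an unshifted sum of length n+1.
pascal-sum : ∀ (T : ℕ → Poly) n →
  sumTo (λ j → scale (ℕ→ℚ (suc n C j)) (T j)) (suc n) ≋
  sumTo (λ j → scale (ℕ→ℚ (n C j)) (T (suc j))) n +ₚ sumTo (λ j → scale (ℕ→ℚ (n C j)) (T j)) n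
pascal-sum T n = begin
  sumTo h (suc n)                               ≈⟨ sum-first h n ⟩
  h 0 +ₚ sumTo (λ j → h (suc j)) n              ≈⟨ +ₚ-congʳ (h 0) (sum-cong n (λ j _ → split j)) ⟩
  h 0 +ₚ sumTo (λ j → shifted j +ₚ B j) n       ≈⟨ +ₚ-congʳ (h 0) (sum-+ shifted B n) ⟩
  h 0 +ₚ (sumTo shifted n +ₚ sumTo B n)         ≈⟨ rotate (h 0) (sumTo shifted n) (sumTo B n) ⟩
  sumTo shifted n +ₚ (h 0 +ₚ sumTo B n)         ≈⟨ +ₚ-congʳ (sumTo shifted n) (≋-sym (sum-first g n)) ⟩
  sumTo shifted n +ₚ sumTo g (suc n)            ≈⟨ +ₚ-congʳ (sumTo shifted n) (sum-last-zero g n last-vanishes) ⟩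
  sumTo shifted n +ₚ sumTo g n                  ∎
  where
  open ≋-Reasoning
  h g shifted B : ℕ → Poly
  h j       = scale (ℕ→ℚ (suc n C j)) (T j)
  g j       = scale (ℕ→ℚ (n C j)) (T j)
  shifted j = scale (ℕ→ℚ (n C j)) (T (suc j))
  B j       = scale (ℕ→ℚ (n C suc j)) (T (suc j))
  split : ∀ j → h (suc j) ≋ shifted j +ₚ B j
  split j = ≋-trans
    (scale-cong (trans (cong ℕ→ℚ (sym (nCk+nC[k+1]≡[n+1]C[k+1] n j))) (ℕ→ℚ-+ (n C j) (n C suc j))) ≋-refl)
    (scale-+ (ℕ→ℚ (n C j)) (ℕ→ℚ (n C suc j)) (T (suc j)))
  last-vanishes : g (suc n) ≋ []
  last-vanishes = ≋-trans (scale-cong (cong ℕ→ℚ (k>n⇒nCk≡0 (ℕP.n<1+n n))) ≋-refl) (scale-zero _)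
  rotate : ∀ a b c → a +ₚ (b +ₚ c) ≋ b +ₚ (a +ₚ c)
  rotate = solve-∀ Poly-ring

-- Everything rests on the Leibniz rule for the shift ∂ (d/dt on
-- exponential generating functions), which lets every ring law be proved by
-- induction on the index.

infix 4 _≋ᶠ_
record _≋ᶠ_ (f g : AF) : Set where
  constructor mk≋ᶠ
  field atᶠ : ∀ k → f k ≋ g k
open _≋ᶠ_

≋ᶠ-refl : ∀ {f} → f ≋ᶠ f
≋ᶠ-refl = mk≋ᶠ λ k → ≋-refl

≋ᶠ-sym : ∀ {f g} → f ≋ᶠ g → g ≋ᶠ f
≋ᶠ-sym e = mk≋ᶠ λ k → ≋-sym (atᶠ e k)

≋ᶠ-trans : ∀ {f g h} → f ≋ᶠ g → g ≋ᶠ h → f ≋ᶠ h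
≋ᶠ-trans e e' = mk≋ᶠ λ k → ≋-trans (atᶠ e k) (atᶠ e' k)

infixl 6 _⊕_
_⊕_ : AF → AF → AF
(f ⊕ g) k = f k +ₚ g k

⊖_ : AF → AF
(⊖ f) k = negₚ (f k)

0ᶠ : AF
0ᶠ k = []

∂ : AF → AF
∂ f k = f (suc k)

∂-cong : ∀ {f g} → f ≋ᶠ g → ∂ f ≋ᶠ ∂ g
∂-cong e = mk≋ᶠ λ k → atᶠ e (suc k)

•-at-zero : ∀ f g → (f • g) 0 ≋ f 0 *ₚ g 0
•-at-zero f g = scale-one (f 0 *ₚ g 0)

-- Leibniz rule:  ∂(f • g) = ∂f • g + f • ∂g  (Pascal's rule in disguise).
leibniz : ∀ f g k → (f • g) (suc k) ≋ (∂ f • g) k +ₚ (f • ∂ g) k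
leibniz f g k = ≋-trans (pascal-sum (λ m → f m *ₚ g (suc k ∸ m)) k)
  (+ₚ-congʳ ((∂ f • g) k) (sum-cong k (λ j j≤k → scale-congʳ (ℕ→ℚ (k C j))
    (*ₚ-congʳ (f j) (≡⇒≋ (cong g (ℕP.+-∸-assoc 1 j≤k)))))))

leibnizᶠ : ∀ f g → ∂ (f • g) ≋ᶠ (∂ f • g) ⊕ (f • ∂ g)
leibnizᶠ f g = mk≋ᶠ (leibniz f g)

•-cong-at : ∀ k {f f' g g'} → f ≋ᶠ f' → g ≋ᶠ g' → (f • g) k ≋ (f' • g') k
•-cong-at zero    {f} {f'} {g} {g'} e e' = ≋-trans (•-at-zero f g)
  (≋-trans (*ₚ-cong (atᶠ e 0) (atᶠ e' 0)) (≋-sym (•-at-zero f' g')))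
•-cong-at (suc k) {f} {f'} {g} {g'} e e' = ≋-trans (leibniz f g k)
  (≋-trans (+ₚ-cong (•-cong-at k (∂-cong e) e') (•-cong-at k e (∂-cong e'))) (≋-sym (leibniz f' g' k)))

•-cong : ∀ {f f' g g'} → f ≋ᶠ f' → g ≋ᶠ g' → f • g ≋ᶠ f' • g'
•-cong e e' = mk≋ᶠ λ k → •-cong-at k e e'

•-comm-at : ∀ k f g → (f • g) k ≋ (g • f) k
•-comm-at zero    f g = ≋-trans (•-at-zero f g) (≋-trans (*ₚ-comm (f 0) (g 0)) (≋-sym (•-at-zero g f)))
•-comm-at (suc k) f g = ≋-trans (leibniz f g k)
  (≋-trans (+ₚ-cong (•-comm-at k (∂ f) g) (•-comm-at k f (∂ g)))
  (≋-trans (+ₚ-comm ((g • ∂ f) k) ((∂ g • f) k)) (≋-sym (leibniz g f k))))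

•-comm : ∀ f g → f • g ≋ᶠ g • f
•-comm f g = mk≋ᶠ λ k → •-comm-at k f g

•-distribˡ-at : ∀ k f g h → (f • (g ⊕ h)) k ≋ (f • g) k +ₚ (f • h) k
•-distribˡ-at zero    f g h = ≋-trans (•-at-zero f (g ⊕ h))
  (≋-trans (*ₚ-distribˡ (f 0) (g 0) (h 0)) (≋-sym (+ₚ-cong (•-at-zero f g) (•-at-zero f h))))
•-distribˡ-at (suc k) f g h = ≋-trans (leibniz f (g ⊕ h) k)
  (≋-trans (+ₚ-cong (•-distribˡ-at k (∂ f) g h) (•-distribˡ-at k f (∂ g) (∂ h)))
  (≋-trans (interchange ((∂ f • g) k) ((∂ f • h) k) ((f • ∂ g) k) ((f • ∂ h) k))
  (≋-sym (+ₚ-cong (leibniz f g k) (leibniz f h k)))))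
  where
  interchange : ∀ a b c d → (a +ₚ b) +ₚ (c +ₚ d) ≋ (a +ₚ c) +ₚ (b +ₚ d)
  interchange = solve-∀ Poly-ring

•-distribˡ : ∀ f g h → f • (g ⊕ h) ≋ᶠ (f • g) ⊕ (f • h)
•-distribˡ f g h = mk≋ᶠ λ k → •-distribˡ-at k f g h

•-distribʳ : ∀ h f g → (f ⊕ g) • h ≋ᶠ (f • h) ⊕ (g • h)
•-distribʳ h f g = mk≋ᶠ λ k → ≋-trans (•-comm-at k (f ⊕ g) h)
  (≋-trans (•-distribˡ-at k h f g) (+ₚ-cong (•-comm-at k h f) (•-comm-at k h g)))

•-assoc-at : ∀ k f g h → ((f • g) • h) k ≋ (f • (g • h)) k
•-assoc-at zero f g h = ≋-trans (•-at-zero (f • g) h)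
  (≋-trans (*ₚ-congˡ (•-at-zero f g) (h 0)) (≋-trans (*ₚ-assoc (f 0) (g 0) (h 0))
  (≋-sym (≋-trans (•-at-zero f (g • h)) (*ₚ-congʳ (f 0) (•-at-zero g h))))))
•-assoc-at (suc k) f g h = begin
  ((f • g) • h) (suc k)
    ≈⟨ leibniz (f • g) h k ⟩
  (∂ (f • g) • h) k +ₚ ((f • g) • ∂ h) k
    ≈⟨ +ₚ-congˡ (≋-trans (•-cong-at k (leibnizᶠ f g) (≋ᶠ-refl {h}))
                         (atᶠ (•-distribʳ h (∂ f • g) (f • ∂ g)) k)) _ ⟩
  (((∂ f • g) • h) k +ₚ ((f • ∂ g) • h) k) +ₚ ((f • g) • ∂ h) k
    ≈⟨ +ₚ-cong (+ₚ-cong (•-assoc-at k (∂ f) g h) (•-assoc-at k f (∂ g) h)) (•-assoc-at k f g (∂ h)) ⟩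
  ((∂ f • (g • h)) k +ₚ (f • (∂ g • h)) k) +ₚ (f • (g • ∂ h)) k
    ≈⟨ +ₚ-assoc ((∂ f • (g • h)) k) ((f • (∂ g • h)) k) ((f • (g • ∂ h)) k) ⟩
  (∂ f • (g • h)) k +ₚ ((f • (∂ g • h)) k +ₚ (f • (g • ∂ h)) k)
    ≈⟨ +ₚ-congʳ _ (≋-sym (•-distribˡ-at k f (∂ g • h) (g • ∂ h))) ⟩
  (∂ f • (g • h)) k +ₚ (f • ((∂ g • h) ⊕ (g • ∂ h))) k
    ≈⟨ +ₚ-congʳ _ (•-cong-at k (≋ᶠ-refl {f}) (≋ᶠ-sym (leibnizᶠ g h))) ⟩
  (∂ f • (g • h)) k +ₚ (f • ∂ (g • h)) k
    ≈⟨ ≋-sym (leibniz f (g • h) k) ⟩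
  (f • (g • h)) (suc k) ∎
  where open ≋-Reasoning

•-assoc : ∀ f g h → (f • g) • h ≋ᶠ f • (g • h)
•-assoc f g h = mk≋ᶠ λ k → •-assoc-at k f g h

0ᶠ•-at : ∀ k f → (0ᶠ • f) k ≋ []
0ᶠ•-at zero    f = •-at-zero 0ᶠ f
0ᶠ•-at (suc k) f = ≋-trans (leibniz 0ᶠ f k) (+ₚ-cong (0ᶠ•-at k f) (0ᶠ•-at k (∂ f)))

0ᶠ• : ∀ f → 0ᶠ • f ≋ᶠ 0ᶠ
0ᶠ• f = mk≋ᶠ λ k → 0ᶠ•-at k f

e•-at : ∀ k f → (eAF • f) k ≋ f k
e•-at zero    f = ≋-trans (•-at-zero eAF f) (*ₚ-identityˡ (f 0))
e•-at (suc k) f = ≋-trans (leibniz eAF f k) (+ₚ-cong (0ᶠ•-at k f) (e•-at k (∂ f)))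

e• : ∀ f → eAF • f ≋ᶠ f
e• f = mk≋ᶠ λ k → e•-at k f

•e : ∀ f → f • eAF ≋ᶠ f
•e f = ≋ᶠ-trans (•-comm f eAF) (e• f)

AF-CR : CommutativeRing _ _
AF-CR = record
  { Carrier = AF ; _≈_ = _≋ᶠ_ ; _+_ = _⊕_ ; _*_ = _•_ ; -_ = ⊖_ ; 0# = 0ᶠ ; 1# = eAF
  ; isCommutativeRing = record
    { isRing = record
      { +-isAbelianGroup = record
        { isGroup = record
          { isMonoid = record
            { isSemigroup = record
              { isMagma = record
                { isEquivalence = record { refl = ≋ᶠ-refl ; sym = ≋ᶠ-sym ; trans = ≋ᶠ-trans }
                ; ∙-cong = λ e e' → mk≋ᶠ λ k → +ₚ-cong (atᶠ e k) (atᶠ e' k) }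
              ; assoc = λ f g h → mk≋ᶠ λ k → +ₚ-assoc (f k) (g k) (h k) }
            ; identity = (λ f → ≋ᶠ-refl) , (λ f → mk≋ᶠ λ k → +ₚ-identityʳ (f k)) }
          ; inverse = (λ f → mk≋ᶠ λ k → negₚ-inverseˡ (f k)) , (λ f → mk≋ᶠ λ k → negₚ-inverseʳ (f k))
          ; ⁻¹-cong = λ e → mk≋ᶠ λ k → negₚ-cong (atᶠ e k) }
        ; comm = λ f g → mk≋ᶠ λ k → +ₚ-comm (f k) (g k) }
      ; *-cong = •-cong
      ; *-assoc = •-assoc
      ; *-identity = e• , •e
      ; distrib = •-distribˡ , •-distribʳ }
    ; *-comm = •-comm } }

module ≋ᶠ-Reasoning = SetoidReasoning (CommutativeRing.setoid AF-CR)

⊕-cong : ∀ {f f' g g'} → f ≋ᶠ f' → g ≋ᶠ g' → f ⊕ g ≋ᶠ f' ⊕ g'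
⊕-cong = CommutativeRing.+-cong AF-CR

•-congˡ : ∀ {f f'} → f ≋ᶠ f' → ∀ g → f • g ≋ᶠ f' • g
•-congˡ e g = •-cong e (≋ᶠ-refl {g})

•-congʳ : ∀ f {g g'} → g ≋ᶠ g' → f • g ≋ᶠ f • g'
•-congʳ f e = •-cong (≋ᶠ-refl {f}) e

infixr 7 _·ᶠ_
_·ᶠ_ : Poly → AF → AF
(c ·ᶠ f) k = c *ₚ f k

·ᶠ-cong : ∀ {c d f g} → c ≋ d → f ≋ᶠ g → c ·ᶠ f ≋ᶠ d ·ᶠ g
·ᶠ-cong e e' = mk≋ᶠ λ k → *ₚ-cong e (atᶠ e' k)

·ᶠ-congʳ : ∀ c {f g} → f ≋ᶠ g → c ·ᶠ f ≋ᶠ c ·ᶠ g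
·ᶠ-congʳ c = ·ᶠ-cong (≋-refl {c})

·ᶠ-assoc : ∀ c d f → c ·ᶠ (d ·ᶠ f) ≋ᶠ (c *ₚ d) ·ᶠ f
·ᶠ-assoc c d f = mk≋ᶠ λ k → ≋-sym (*ₚ-assoc c d (f k))

·ᶠ-distrib : ∀ a b f → (a ·ᶠ f) ⊕ (b ·ᶠ f) ≋ᶠ (a +ₚ b) ·ᶠ f
·ᶠ-distrib a b f = mk≋ᶠ λ k → ≋-sym (*ₚ-distribʳ (f k) a b)

·ᶠ-identity : ∀ f → oneₚ ·ᶠ f ≋ᶠ f
·ᶠ-identity f = mk≋ᶠ λ k → *ₚ-identityˡ (f k)

·•-at : ∀ k c f g → ((c ·ᶠ f) • g) k ≋ c *ₚ (f • g) k
·•-at zero    c f g = ≋-trans (•-at-zero (c ·ᶠ f) g)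
  (≋-trans (*ₚ-assoc c (f 0) (g 0)) (*ₚ-congʳ c (≋-sym (•-at-zero f g))))
·•-at (suc k) c f g = ≋-trans (leibniz (c ·ᶠ f) g k)
  (≋-trans (+ₚ-cong (·•-at k c (∂ f) g) (·•-at k c f (∂ g)))
  (≋-trans (≋-sym (*ₚ-distribˡ c ((∂ f • g) k) ((f • ∂ g) k))) (*ₚ-congʳ c (≋-sym (leibniz f g k)))))

·• : ∀ c f g → (c ·ᶠ f) • g ≋ᶠ c ·ᶠ (f • g)
·• c f g = mk≋ᶠ λ k → ·•-at k c f g

•· : ∀ c f g → f • (c ·ᶠ g) ≋ᶠ c ·ᶠ (f • g)
•· c f g = mk≋ᶠ λ k → ≋-trans (•-comm-at k f (c ·ᶠ g))
  (≋-trans (·•-at k c g f) (*ₚ-congʳ c (•-comm-at k g f)))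

-- Powers.  Defs' powAF agrees with the power of the ring AF-CR, so the library's
-- exponent laws and binomial theorem apply to it.

AF-CS : CommutativeSemiring _ _
AF-CS = CommutativeRing.commutativeSemiring AF-CR
open SemiringExp (CommutativeRing.semiring AF-CR) using (_^_)
open RawMonoidDefinitions (CommutativeRing.+-rawMonoid AF-CR) using (sum) renaming (_×_ to _×ᶠ_)

powAF≈^ : ∀ f n → powAF f n ≋ᶠ f ^ n
powAF≈^ f zero    = ≋ᶠ-refl
powAF≈^ f (suc n) = •-congʳ f (powAF≈^ f n)

powAF-cong : ∀ {f g} n → f ≋ᶠ g → powAF f n ≋ᶠ powAF g n
powAF-cong zero    e = ≋ᶠ-refl
powAF-cong (suc n) e = •-cong e (powAF-cong n e)

powAF-distrib-• : ∀ f g n → powAF (f • g) n ≋ᶠ powAF f n • powAF g n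
powAF-distrib-• f g n = ≋ᶠ-trans (powAF≈^ (f • g) n)
  (≋ᶠ-trans (CommutativeSemiringExp.^-distrib-* AF-CS f g n)
            (≋ᶠ-sym (•-cong (powAF≈^ f n) (powAF≈^ g n))))

powAF-e : ∀ n → powAF eAF n ≋ᶠ eAF
powAF-e zero    = ≋ᶠ-refl
powAF-e (suc n) = ≋ᶠ-trans (e• (powAF eAF n)) (powAF-e n)

×ᶠ-at : ∀ c f k → (c ×ᶠ f) k ≋ scale (ℕ→ℚ c) (f k)
×ᶠ-at zero    f k = ≋-sym (scale-zero (f k))
×ᶠ-at (suc c) f k = ≋-trans (+ₚ-congʳ (f k) (×ᶠ-at c f k)) (≋-sym (scale-suc c (f k)))

sum-at : ∀ n (F : ℕ → AF) k → sum {suc n} (λ j → F (toℕ j)) k ≋ sumTo (λ j → F j k) n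
sum-at zero    F k = +ₚ-identityʳ (F 0 k)
sum-at (suc n) F k = ≋-trans (+ₚ-congʳ (F 0 k) (sum-at n (λ j → F (suc j)) k))
  (≋-sym (sum-first (λ j → F j k) n))

binomial-at : ∀ A B n k →
  powAF (A ⊕ B) n k ≋ sumTo (λ j → scale (ℕ→ℚ (n C j)) ((powAF A j • powAF B (n ∸ j)) k)) n
binomial-at A B n k = begin
  powAF (A ⊕ B) n k
    ≈⟨ atᶠ (≋ᶠ-trans (powAF≈^ (A ⊕ B) n) (Binomial.theorem AF-CS n A B)) k ⟩
  sum {suc n} (λ j → (n C toℕ j) ×ᶠ ((A ^ toℕ j) • (B ^ (n ∸ toℕ j)))) k
    ≈⟨ sum-at n (λ j → (n C j) ×ᶠ ((A ^ j) • (B ^ (n ∸ j)))) k ⟩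
  sumTo (λ j → ((n C j) ×ᶠ ((A ^ j) • (B ^ (n ∸ j)))) k) n
    ≈⟨ sum-cong n (λ j _ → ≋-trans (×ᶠ-at (n C j) _ k) (scale-congʳ (ℕ→ℚ (n C j))
         (•-cong-at k (≋ᶠ-sym (powAF≈^ A j)) (≋ᶠ-sym (powAF≈^ B (n ∸ j)))))) ⟩
  sumTo (λ j → scale (ℕ→ℚ (n C j)) ((powAF A j • powAF B (n ∸ j)) k)) n ∎
  where open ≋-Reasoning

inverse-unique : ∀ F g h → F • g ≋ᶠ eAF → F • h ≋ᶠ eAF → g ≋ᶠ h
inverse-unique F g h Fg≈e Fh≈e = begin
  g             ≈⟨ ≋ᶠ-sym (•e g) ⟩
  g • eAF       ≈⟨ •-congʳ g (≋ᶠ-sym Fh≈e) ⟩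
  g • (F • h)   ≈⟨ ≋ᶠ-sym (•-assoc g F h) ⟩
  (g • F) • h   ≈⟨ •-congˡ (•-comm g F) h ⟩
  (F • g) • h   ≈⟨ •-congˡ Fg≈e h ⟩
  eAF • h       ≈⟨ e• h ⟩
  h             ∎
  where open ≋ᶠ-Reasoning

-- Exponentials:  E a  (k ↦ aᵏ)  is the generating function e^{at}.

E : Poly → AF
E a k = a ^ₚ k

E-cong : ∀ {a b} → a ≋ b → E a ≋ᶠ E b
E-cong {a} {b} e = mk≋ᶠ power-cong
  where
  power-cong : ∀ k → a ^ₚ k ≋ b ^ₚ k
  power-cong zero    = ≋-refl
  power-cong (suc k) = *ₚ-cong e (power-cong k)

E-zero : E [] ≋ᶠ eAF
E-zero = mk≋ᶠ λ { zero → ≋-refl ; (suc k) → ≋-refl }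

E-+-at : ∀ k a b → (E a • E b) k ≋ (a +ₚ b) ^ₚ k
E-+-at zero    a b = ≋-trans (•-at-zero (E a) (E b)) (*ₚ-identityˡ oneₚ)
E-+-at (suc k) a b = begin
  (E a • E b) (suc k)                           ≈⟨ leibniz (E a) (E b) k ⟩
  ((a ·ᶠ E a) • E b) k +ₚ (E a • (b ·ᶠ E b)) k  ≈⟨ +ₚ-cong (·•-at k a (E a) (E b)) (atᶠ (•· b (E a) (E b)) k) ⟩
  a *ₚ (E a • E b) k +ₚ b *ₚ (E a • E b) k      ≈⟨ ≋-sym (*ₚ-distribʳ ((E a • E b) k) a b) ⟩
  (a +ₚ b) *ₚ (E a • E b) k                     ≈⟨ *ₚ-congʳ (a +ₚ b) (E-+-at k a b) ⟩
  (a +ₚ b) ^ₚ suc k                             ∎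
  where open ≋-Reasoning

E-+ : ∀ a b → E a • E b ≋ᶠ E (a +ₚ b)
E-+ a b = mk≋ᶠ λ k → E-+-at k a b

powAF-E : ∀ a j → powAF (E a) j ≋ᶠ E (scale (ℕ→ℚ j) a)
powAF-E a zero    = ≋ᶠ-sym (≋ᶠ-trans (E-cong (scale-zero a)) E-zero)
powAF-E a (suc j) = ≋ᶠ-trans (•-congʳ (E a) (powAF-E a j))
  (≋ᶠ-trans (E-+ a (scale (ℕ→ℚ j) a)) (E-cong (≋-sym (scale-suc j a))))

-- τ is multiplication by t:  τf(0) = 0,  τf(k+1) = (k+1) f(k).

τ : AF → AF
τ f zero    = []
τ f (suc k) = scale (ℕ→ℚ (suc k)) (f k)

τ-cong : ∀ {f g} → f ≋ᶠ g → τ f ≋ᶠ τ g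
τ-cong e = mk≋ᶠ λ { zero → ≋-refl ; (suc k) → scale-congʳ (ℕ→ℚ (suc k)) (atᶠ e k) }

τ-⊕ : ∀ f g → τ (f ⊕ g) ≋ᶠ τ f ⊕ τ g
τ-⊕ f g = mk≋ᶠ λ { zero → ≋-refl ; (suc k) → scale-+ₚ (ℕ→ℚ (suc k)) (f k) (g k) }

∂τ : ∀ f → ∂ (τ f) ≋ᶠ f ⊕ τ (∂ f)
∂τ f = mk≋ᶠ λ { zero    → ≋-trans (scale-one (f 0)) (≋-sym (+ₚ-identityʳ (f 0)))
              ; (suc k) → scale-suc (suc k) (f (suc k)) }

τ∂ : ∀ f k → τ (∂ f) k ≋ scale (ℕ→ℚ k) (f k)
τ∂ f zero    = ≋-sym (scale-zero (f 0))
τ∂ f (suc k) = ≋-refl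

τ-•-at : ∀ k f g → τ (f • g) k ≋ (τ f • g) k
τ-•-at zero    f g = ≋-sym (•-at-zero (τ f) g)
τ-•-at (suc k) f g = ≋-sym (begin
  (τ f • g) (suc k)
    ≈⟨ leibniz (τ f) g k ⟩
  (∂ (τ f) • g) k +ₚ (τ f • ∂ g) k
    ≈⟨ +ₚ-congˡ (≋-trans (•-cong-at k (∂τ f) (≋ᶠ-refl {g})) (atᶠ (•-distribʳ g f (τ (∂ f))) k)) _ ⟩
  ((f • g) k +ₚ (τ (∂ f) • g) k) +ₚ (τ f • ∂ g) k
    ≈⟨ +ₚ-cong (+ₚ-congʳ ((f • g) k) (≋-sym (τ-•-at k (∂ f) g))) (≋-sym (τ-•-at k f (∂ g))) ⟩
  ((f • g) k +ₚ τ (∂ f • g) k) +ₚ τ (f • ∂ g) k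
    ≈⟨ +ₚ-assoc ((f • g) k) (τ (∂ f • g) k) (τ (f • ∂ g) k) ⟩
  (f • g) k +ₚ (τ (∂ f • g) k +ₚ τ (f • ∂ g) k)
    ≈⟨ +ₚ-congʳ ((f • g) k) (≋-trans (≋-sym (atᶠ (τ-⊕ (∂ f • g) (f • ∂ g)) k))
                                     (atᶠ (τ-cong (≋ᶠ-sym (leibnizᶠ f g))) k)) ⟩
  (f • g) k +ₚ τ (∂ (f • g)) k
    ≈⟨ +ₚ-congʳ ((f • g) k) (τ∂ (f • g) k) ⟩
  (f • g) k +ₚ scale (ℕ→ℚ k) ((f • g) k)
    ≈⟨ ≋-sym (scale-suc k ((f • g) k)) ⟩
  τ (f • g) (suc k) ∎)
  where open ≋-Reasoning

τ-•ˡ : ∀ f g → τ (f • g) ≋ᶠ τ f • g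
τ-•ˡ f g = mk≋ᶠ λ k → τ-•-at k f g

τ-•ʳ : ∀ f g → τ (f • g) ≋ᶠ f • τ g
τ-•ʳ f g = ≋ᶠ-trans (τ-cong (•-comm f g)) (≋ᶠ-trans (τ-•ˡ g f) (•-comm (τ g) f))

-- 1/(k+1), the k-th coefficient of (eᵗ-1)/t.
recip : ℕ → ℚ
recip k = + 1 / suc k

recip-suc : ∀ k → recip k * ℕ→ℚ (suc k) ≡ 1ℚ
recip-suc k = recip-inverse (suc k)

-- Multiplication by t is injective (we are in characteristic zero).
τ-injective : ∀ {f g} → τ f ≋ᶠ τ g → f ≋ᶠ g
τ-injective {f} {g} e = mk≋ᶠ λ k → begin
  f k                                  ≈⟨ ≋-sym (scale-one (f k)) ⟩
  scale 1ℚ (f k)                       ≈⟨ scale-cong (sym (recip-suc k)) (≋-refl {f k}) ⟩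
  scale (recip k * ℕ→ℚ (suc k)) (f k)  ≈⟨ ≋-sym (scale-scale (recip k) (ℕ→ℚ (suc k)) (f k)) ⟩
  scale (recip k) (τ f (suc k))        ≈⟨ scale-congʳ (recip k) (atᶠ e (suc k)) ⟩
  scale (recip k) (τ g (suc k))        ≈⟨ scale-scale (recip k) (ℕ→ℚ (suc k)) (g k) ⟩
  scale (recip k * ℕ→ℚ (suc k)) (g k)  ≈⟨ scale-cong (recip-suc k) (≋-refl {g k}) ⟩
  scale 1ℚ (g k)                       ≈⟨ scale-one (g k) ⟩
  g k                                  ∎
  where open ≋-Reasoning

-- D plays (eᵗ-1)/t and U plays eᵗ-1.
D : AF
D k = constₚ (recip k)

U : AF
U zero    = []
U (suc k) = oneₚ

τD≈U : τ D ≋ᶠ U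
τD≈U = mk≋ᶠ λ { zero    → ≋-refl
              ; (suc k) → mk≋ λ { zero    → trans (ℚP.*-comm (ℕ→ℚ (suc k)) (recip k)) (recip-suc k)
                                ; (suc i) → refl } }

U≈E₁-e : U ≋ᶠ E oneₚ ⊕ (⊖ eAF)
U≈E₁-e = mk≋ᶠ λ { zero    → ≋-sym (negₚ-inverseʳ oneₚ)
                ; (suc k) → ≋-sym (≋-trans (+ₚ-identityʳ (oneₚ ^ₚ suc k)) (one-^ (suc k))) }
  where
  one-^ : ∀ k → oneₚ ^ₚ k ≋ oneₚ
  one-^ zero    = ≋-refl
  one-^ (suc k) = ≋-trans (*ₚ-congʳ oneₚ (one-^ k)) (*ₚ-identityˡ oneₚ)

-- Unfolding Defs' list-based construction gives the
-- classical recurrence  Σ_{j≤m} C(m+1,j) B_j(x) = (m+1) xᵐ,  which says exactly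
-- 𝓑 • U = τ Eₓ  (B(x,t)(eᵗ-1) = t e^{xt}),  i.e.  D • 𝓑 = Eₓ  after cancelling t.

length-bernList : ∀ k → length (bernList k) ≡ suc k
length-bernList zero    = refl
length-bernList (suc k) = trans (ListP.length-++ (bernList k))
  (trans (ℕP.+-comm (length (bernList k)) 1) (cong suc (length-bernList k)))

nthₚ-last : ∀ xs y j → j ≡ length xs → nthₚ (xs ++ y ∷ []) j ≡ y
nthₚ-last []       y zero    refl = refl
nthₚ-last (x ∷ xs) y (suc j) eq   = nthₚ-last xs y j (ℕP.suc-injective eq)

binomialSum : ℕ → ℕ → Poly
binomialSum m k = sumIdx (λ j p → scale (ℕ→ℚ (m C j)) p) 0 (bernList k)

bernoulli-suc : ∀ k →
  bernoulli (suc k) ≡ (Xₚ ^ₚ suc k) -ₚ scale (recip (suc k)) (binomialSum (suc (suc k)) k)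
bernoulli-suc k = nthₚ-last (bernList k) _ (suc k) (sym (length-bernList k))

sumIdx-snoc : ∀ (f : ℕ → Poly → Poly) i xs y →
  sumIdx f i (xs ++ y ∷ []) ≋ sumIdx f i xs +ₚ f (i +ℕ length xs) y
sumIdx-snoc f i []       y = ≋-trans (+ₚ-identityʳ (f i y)) (≡⇒≋ (cong (λ n → f n y) (sym (ℕP.+-identityʳ i))))
sumIdx-snoc f i (x ∷ xs) y = ≋-trans (+ₚ-congʳ (f i x) (sumIdx-snoc f (suc i) xs y))
  (≋-trans (≋-sym (+ₚ-assoc (f i x) (sumIdx f (suc i) xs) (f (suc i +ℕ length xs) y)))
  (+ₚ-congʳ (sumIdx f i (x ∷ xs)) (≡⇒≋ (cong (λ n → f n y) (sym (ℕP.+-suc i (length xs)))))))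

sumIdx-bernList : ∀ (f : ℕ → Poly → Poly) k → sumIdx f 0 (bernList k) ≋ sumTo (λ j → f j (bernoulli j)) k
sumIdx-bernList f zero    = +ₚ-identityʳ (f 0 oneₚ)
sumIdx-bernList f (suc k) = ≋-trans (sumIdx-snoc f 0 (bernList k) _)
  (+ₚ-cong (sumIdx-bernList f k) (≡⇒≋ (cong₂ f (length-bernList k) (sym (bernoulli-suc k)))))

solve-recurrence : ∀ (S A : Poly) c d → d * c ≡ 1ℚ → S +ₚ scale c (A -ₚ scale d S) ≋ scale c A
solve-recurrence S A c d dc≡1 = begin
  S +ₚ scale c (A -ₚ scale d S)
    ≈⟨ +ₚ-congʳ S (≋-trans (scale-const c _) (*ₚ-congʳ (constₚ c) (+ₚ-congʳ A (negₚ-cong (scale-const d S))))) ⟩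
  S +ₚ constₚ c *ₚ (A +ₚ negₚ (constₚ d *ₚ S))
    ≈⟨ expand S A (constₚ c) (constₚ d) ⟩
  constₚ c *ₚ A +ₚ (S +ₚ negₚ ((constₚ d *ₚ constₚ c) *ₚ S))
    ≈⟨ +ₚ-congʳ (constₚ c *ₚ A) (+ₚ-congʳ S (negₚ-cong (≋-trans (*ₚ-congˡ dc≈1 S) (*ₚ-identityˡ S)))) ⟩
  constₚ c *ₚ A +ₚ (S +ₚ negₚ S)
    ≈⟨ ≋-trans (+ₚ-congʳ (constₚ c *ₚ A) (negₚ-inverseʳ S)) (+ₚ-identityʳ (constₚ c *ₚ A)) ⟩
  constₚ c *ₚ A
    ≈⟨ ≋-sym (scale-const c A) ⟩
  scale c A ∎
  where
  open ≋-Reasoning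
  expand : ∀ S A c d → S +ₚ c *ₚ (A +ₚ negₚ (d *ₚ S)) ≋ c *ₚ A +ₚ (S +ₚ negₚ ((d *ₚ c) *ₚ S))
  expand = solve-∀ Poly-ring
  dc≈1 : constₚ d *ₚ constₚ c ≋ oneₚ
  dc≈1 = ≋-trans (≋-sym (const-* d c)) (≡⇒≋ (cong constₚ dc≡1))

[n+1]Cn≡n+1 : ∀ n → suc n C n ≡ suc n
[n+1]Cn≡n+1 n = trans (nCk≡nC[n∸k] (ℕP.n≤1+n n)) (trans (cong (suc n C_) (ℕP.m+n∸n≡m 1 n)) (nC1≡n (suc n)))

bernoulli-recurrence : ∀ m → sumTo (λ j → scale (ℕ→ℚ (suc m C j)) (bernoulli j)) m ≋ scale (ℕ→ℚ (suc m)) (Xₚ ^ₚ m)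
bernoulli-recurrence zero    = ≋-refl
bernoulli-recurrence (suc k) = begin
  sumTo (λ j → scale (ℕ→ℚ (suc (suc k) C j)) (bernoulli j)) k
    +ₚ scale (ℕ→ℚ (suc (suc k) C suc k)) (bernoulli (suc k))
    ≈⟨ +ₚ-cong (≋-sym (sumIdx-bernList (λ j p → scale (ℕ→ℚ (suc (suc k) C j)) p) k))
               (scale-cong (cong ℕ→ℚ ([n+1]Cn≡n+1 (suc k))) (≡⇒≋ (bernoulli-suc k))) ⟩
  binomialSum (suc (suc k)) k
    +ₚ scale (ℕ→ℚ (suc (suc k))) ((Xₚ ^ₚ suc k) -ₚ scale (recip (suc k)) (binomialSum (suc (suc k)) k))
    ≈⟨ solve-recurrence (binomialSum (suc (suc k)) k) (Xₚ ^ₚ suc k) (ℕ→ℚ (suc (suc k))) (recip (suc k))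
                        (recip-suc (suc k)) ⟩
  scale (ℕ→ℚ (suc (suc k))) (Xₚ ^ₚ suc k) ∎
  where open ≋-Reasoning

𝓑•U≈τEₓ : 𝓑 • U ≋ᶠ τ (E Xₚ)
𝓑•U≈τEₓ = mk≋ᶠ λ
  { zero    → ≋-trans (•-at-zero 𝓑 U) (*ₚ-zeroʳ (𝓑 0))
  ; (suc m) → ≋-trans (sum-last-zero _ m (last-vanishes m))
      (≋-trans (sum-cong m (λ j j≤m → scale-congʳ (ℕ→ℚ (suc m C j))
                 (≋-trans (*ₚ-congʳ (𝓑 j) (≡⇒≋ (cong U (ℕP.+-∸-assoc 1 j≤m)))) (*ₚ-identityʳ (𝓑 j)))))
      (bernoulli-recurrence m)) }
  where
  last-vanishes : ∀ m → scale (ℕ→ℚ (suc m C suc m)) (𝓑 (suc m) *ₚ U (suc m ∸ suc m)) ≋ []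
  last-vanishes m = scale-congʳ (ℕ→ℚ (suc m C suc m))
    (≋-trans (*ₚ-congʳ (𝓑 (suc m)) (≡⇒≋ (cong U (ℕP.n∸n≡0 m)))) (*ₚ-zeroʳ (𝓑 (suc m))))

D•𝓑≈Eₓ : D • 𝓑 ≋ᶠ E Xₚ
D•𝓑≈Eₓ = τ-injective (≋ᶠ-trans (τ-•ˡ D 𝓑)
  (≋ᶠ-trans (•-congˡ τD≈U 𝓑) (≋ᶠ-trans (•-comm U 𝓑) 𝓑•U≈τEₓ)))

-- The inverse of 𝓑ⁿ.  Since D • 𝓑 = Eₓ and Eₓ • E₋ₓ = e, the function
-- P = D • E₋ₓ  inverts 𝓑, hence Pⁿ inverts 𝓑ⁿ, and it is the only inverse.

-x : Poly
-x = negₚ Xₚ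

P : AF
P = D • E -x

𝓑•P≈e : 𝓑 • P ≋ᶠ eAF
𝓑•P≈e = begin
  𝓑 • (D • E -x)   ≈⟨ ≋ᶠ-sym (•-assoc 𝓑 D (E -x)) ⟩
  (𝓑 • D) • E -x   ≈⟨ •-congˡ (≋ᶠ-trans (•-comm 𝓑 D) D•𝓑≈Eₓ) (E -x) ⟩
  E Xₚ • E -x      ≈⟨ E-+ Xₚ -x ⟩
  E (Xₚ +ₚ -x)     ≈⟨ E-cong (negₚ-inverseʳ Xₚ) ⟩
  E []             ≈⟨ E-zero ⟩
  eAF              ∎
  where open ≋ᶠ-Reasoning

𝓑ⁿ•Pⁿ≈e : ∀ n → powAF 𝓑 n • powAF P n ≋ᶠ eAF
𝓑ⁿ•Pⁿ≈e n = ≋ᶠ-trans (≋ᶠ-sym (powAF-distrib-• 𝓑 P n)) (≋ᶠ-trans (powAF-cong n 𝓑•P≈e) (powAF-e n))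

inverse⇒≋ᶠ : ∀ f g → IsInverse f g → f • g ≋ᶠ eAF
inverse⇒≋ᶠ f g inv = mk≋ᶠ λ k → mk≋ (inv k)

inverse-of-𝓑ⁿ : ∀ n g → IsInverse (powAF 𝓑 n) g → g ≋ᶠ powAF P n
inverse-of-𝓑ⁿ n g inv = inverse-unique (powAF 𝓑 n) g (powAF P n) (inverse⇒≋ᶠ (powAF 𝓑 n) g inv) (𝓑ⁿ•Pⁿ≈e n)

-- The explicit formula.  τP = τD • E₋ₓ = (E₁ - e) • E₋ₓ = E_{1-x} - E₋ₓ; the n-th
-- power of this is expanded by the binomial theorem.

-1ₚ : Poly
-1ₚ = constₚ (- 1ℚ)

1-x : Poly
1-x = oneₚ +ₚ -x

τP≈E₁₋ₓ-E₋ₓ : τ P ≋ᶠ E 1-x ⊕ (-1ₚ ·ᶠ E -x)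
τP≈E₁₋ₓ-E₋ₓ = begin
  τ (D • E -x)                   ≈⟨ τ-•ˡ D (E -x) ⟩
  τ D • E -x                     ≈⟨ •-congˡ (≋ᶠ-trans τD≈U U≈E₁-e) (E -x) ⟩
  (E oneₚ ⊕ (⊖ eAF)) • E -x      ≈⟨ •-distribʳ (E -x) (E oneₚ) (⊖ eAF) ⟩
  (E oneₚ • E -x) ⊕ ((⊖ eAF) • E -x)
    ≈⟨ ⊕-cong (E-+ oneₚ -x) (≋ᶠ-trans (•-congˡ (mk≋ᶠ λ k → scale-const (- 1ℚ) (eAF k)) (E -x))
                             (≋ᶠ-trans (·• -1ₚ eAF (E -x)) (·ᶠ-congʳ -1ₚ (e• (E -x))))) ⟩
  E 1-x ⊕ (-1ₚ ·ᶠ E -x)          ∎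
  where open ≋ᶠ-Reasoning

τⁿ : ℕ → AF → AF
τⁿ zero    f = f
τⁿ (suc n) f = τ (τⁿ n f)

τⁿ-•ʳ : ∀ n f g → τⁿ n (f • g) ≋ᶠ f • τⁿ n g
τⁿ-•ʳ zero    f g = ≋ᶠ-refl
τⁿ-•ʳ (suc n) f g = ≋ᶠ-trans (τ-cong (τⁿ-•ʳ n f g)) (τ-•ʳ f (τⁿ n g))

τⁿ-powAF : ∀ f n → τⁿ n (powAF f n) ≋ᶠ powAF (τ f) n
τⁿ-powAF f zero    = ≋ᶠ-refl
τⁿ-powAF f (suc n) = ≋ᶠ-trans (τ-cong (≋ᶠ-trans (τⁿ-•ʳ n f (powAF f n)) (•-congʳ f (τⁿ-powAF f n))))
  (τ-•ˡ f (powAF (τ f) n))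

τⁿ-at : ∀ n f k → scale (ℕ→ℚ (k !)) (τⁿ n f (k +ℕ n)) ≋ scale (ℕ→ℚ ((k +ℕ n) !)) (f k)
τⁿ-at zero f k rewrite ℕP.+-identityʳ k = ≋-refl
τⁿ-at (suc n) f k rewrite ℕP.+-suc k n = begin
  scale k! (scale m+1 (τⁿ n f m))       ≈⟨ scale-scale k! m+1 _ ⟩
  scale (k! * m+1) (τⁿ n f m)           ≈⟨ scale-cong (ℚP.*-comm k! m+1) (≋-refl {τⁿ n f m}) ⟩
  scale (m+1 * k!) (τⁿ n f m)           ≈⟨ ≋-sym (scale-scale m+1 k! _) ⟩
  scale m+1 (scale k! (τⁿ n f m))       ≈⟨ scale-congʳ m+1 (τⁿ-at n f k) ⟩
  scale m+1 (scale (ℕ→ℚ (m !)) (f k))   ≈⟨ scale-scale m+1 (ℕ→ℚ (m !)) (f k) ⟩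
  scale (m+1 * ℕ→ℚ (m !)) (f k)         ≈⟨ scale-cong (sym (ℕ→ℚ-* (suc m) (m !))) (≋-refl {f k}) ⟩
  scale (ℕ→ℚ (suc m !)) (f k)           ∎
  where
  open ≋-Reasoning
  m : ℕ
  m = k +ℕ n
  k! m+1 : ℚ
  k! = ℕ→ℚ (k !)
  m+1 = ℕ→ℚ (suc m)

-1ₚ-^ : ∀ m → -1ₚ ^ₚ m ≋ constₚ (sgn m)
-1ₚ-^ zero    = ≋-refl
-1ₚ-^ (suc m) = ≋-trans (*ₚ-congʳ -1ₚ (-1ₚ-^ m))
  (≋-trans (≋-sym (const-* (- 1ℚ) (sgn m))) (≡⇒≋ (cong constₚ (minus-one (sgn m)))))
  where
  minus-one : ∀ a → (- 1ℚ) * a ≡ - a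
  minus-one = solve-∀ ℚ-ring

powAF-·ᶠ : ∀ c f m → powAF (c ·ᶠ f) m ≋ᶠ (c ^ₚ m) ·ᶠ powAF f m
powAF-·ᶠ c f zero    = mk≋ᶠ λ k → ≋-sym (*ₚ-identityˡ (eAF k))
powAF-·ᶠ c f (suc m) = ≋ᶠ-trans (•-congʳ (c ·ᶠ f) (powAF-·ᶠ c f m))
  (≋ᶠ-trans (·• c f ((c ^ₚ m) ·ᶠ powAF f m)) (≋ᶠ-trans (·ᶠ-congʳ c (•· (c ^ₚ m) f (powAF f m)))
  (·ᶠ-assoc c (c ^ₚ m) (f • powAF f m))))

linear : ℕ → ℕ → Poly
linear n j = constₚ (ℕ→ℚ j) -ₚ scale (ℕ→ℚ n) Xₚ

j[1-x]+[n-j][-x] : ∀ n j → j ≤ n → scale (ℕ→ℚ j) 1-x +ₚ scale (ℕ→ℚ (n ∸ j)) -x ≋ linear n j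
j[1-x]+[n-j][-x] n j j≤n = begin
  scale J 1-x +ₚ scale K -x                    ≈⟨ +ₚ-cong (scale-const J 1-x) (scale-const K -x) ⟩
  constₚ J *ₚ 1-x +ₚ constₚ K *ₚ -x            ≈⟨ collect (constₚ J) (constₚ K) Xₚ ⟩
  constₚ J -ₚ (constₚ K +ₚ constₚ J) *ₚ Xₚ     ≈⟨ +ₚ-congʳ (constₚ J) (negₚ-cong (≋-sym
                                                    (≋-trans (scale-cong n≡K+J (≋-refl {Xₚ})) (scale-const (K + J) Xₚ)))) ⟩
  linear n j                                   ∎
  where
  open ≋-Reasoning
  J K : ℚ
  J = ℕ→ℚ j
  K = ℕ→ℚ (n ∸ j)
  n≡K+J : ℕ→ℚ n ≡ K + J
  n≡K+J = trans (cong ℕ→ℚ (sym (ℕP.m∸n+n≡m j≤n))) (ℕ→ℚ-+ (n ∸ j) j)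
  collect : ∀ J K X → J *ₚ (oneₚ +ₚ negₚ X) +ₚ K *ₚ negₚ X ≋ J +ₚ negₚ ((K +ₚ J) *ₚ X)
  collect = solve-∀ Poly-ring

binomial-term : ∀ n j → j ≤ n →
  powAF (E 1-x) j • powAF (-1ₚ ·ᶠ E -x) (n ∸ j) ≋ᶠ constₚ (sgn (n ∸ j)) ·ᶠ E (linear n j)
binomial-term n j j≤n = begin
  powAF (E 1-x) j • powAF (-1ₚ ·ᶠ E -x) (n ∸ j)
    ≈⟨ •-cong (powAF-E 1-x j) (≋ᶠ-trans (powAF-·ᶠ -1ₚ (E -x) (n ∸ j)) (·ᶠ-cong (-1ₚ-^ (n ∸ j)) (powAF-E -x (n ∸ j)))) ⟩
  E (scale (ℕ→ℚ j) 1-x) • (constₚ (sgn (n ∸ j)) ·ᶠ E (scale (ℕ→ℚ (n ∸ j)) -x))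
    ≈⟨ •· (constₚ (sgn (n ∸ j))) (E (scale (ℕ→ℚ j) 1-x)) (E (scale (ℕ→ℚ (n ∸ j)) -x)) ⟩
  constₚ (sgn (n ∸ j)) ·ᶠ (E (scale (ℕ→ℚ j) 1-x) • E (scale (ℕ→ℚ (n ∸ j)) -x))
    ≈⟨ ·ᶠ-congʳ (constₚ (sgn (n ∸ j))) (≋ᶠ-trans (E-+ _ _) (E-cong (j[1-x]+[n-j][-x] n j j≤n))) ⟩
  constₚ (sgn (n ∸ j)) ·ᶠ E (linear n j) ∎
  where open ≋ᶠ-Reasoning

alternatingSum : ℕ → ℕ → Poly
alternatingSum n m = sumTo (λ j → scale (ℕ→ℚ (n C j) * sgn (n ∸ j)) (linear n j ^ₚ m)) n

τⁿPⁿ-at : ∀ n m → τⁿ n (powAF P n) m ≋ alternatingSum n m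
τⁿPⁿ-at n m = begin
  τⁿ n (powAF P n) m
    ≈⟨ atᶠ (≋ᶠ-trans (τⁿ-powAF P n) (powAF-cong n τP≈E₁₋ₓ-E₋ₓ)) m ⟩
  powAF (E 1-x ⊕ (-1ₚ ·ᶠ E -x)) n m
    ≈⟨ binomial-at (E 1-x) (-1ₚ ·ᶠ E -x) n m ⟩
  sumTo (λ j → scale (ℕ→ℚ (n C j)) ((powAF (E 1-x) j • powAF (-1ₚ ·ᶠ E -x) (n ∸ j)) m)) n
    ≈⟨ sum-cong n (λ j j≤n → ≋-trans (scale-congʳ (ℕ→ℚ (n C j))
         (≋-trans (atᶠ (binomial-term n j j≤n) m) (≋-sym (scale-const (sgn (n ∸ j)) _))))
         (scale-scale (ℕ→ℚ (n C j)) (sgn (n ∸ j)) _)) ⟩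
  alternatingSum n m ∎
  where open ≋-Reasoning

Pⁿ-formula : ∀ n k → powAF P n k ≋ invFormula n k
Pⁿ-formula n k = begin
  Pⁿ k                                    ≈⟨ ≋-sym (scale-one (Pⁿ k)) ⟩
  scale 1ℚ (Pⁿ k)                         ≈⟨ scale-cong (sym (recip-inverse b {{b≢0}})) (≋-refl {Pⁿ k}) ⟩
  scale (1/b * ℕ→ℚ b) (Pⁿ k)              ≈⟨ ≋-sym (scale-scale 1/b (ℕ→ℚ b) (Pⁿ k)) ⟩
  scale 1/b (scale (ℕ→ℚ b) (Pⁿ k))        ≈⟨ scale-congʳ 1/b (≋-sym (τⁿ-at n (powAF P n) k)) ⟩
  scale 1/b (scale (ℕ→ℚ a) (τⁿ n Pⁿ (k +ℕ n)))
                                          ≈⟨ scale-scale 1/b (ℕ→ℚ a) _ ⟩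
  scale (1/b * ℕ→ℚ a) (τⁿ n Pⁿ (k +ℕ n))  ≈⟨ scale-cong (trans (ℚP.*-comm 1/b (ℕ→ℚ a)) (sym (fraction-as-product a b {{b≢0}})))
                                                        (τⁿPⁿ-at n (k +ℕ n)) ⟩
  invFormula n k                          ∎
  where
  open ≋-Reasoning
  Pⁿ : AF
  Pⁿ = powAF P n
  a b : ℕ
  a = k !
  b = (k +ℕ n) !
  b≢0 : NonZero b
  b≢0 = (k +ℕ n) ℕP.!≢0
  1/b : ℚ
  1/b = (+ 1 / b) {{b≢0}}

-- The sign twist  σf(k) = (-1)ᵏ f(k)  (t ↦ -t) is a ring endomorphism of
-- AF, and so is the reflection x ↦ 1-x applied pointwise.  Applying them to
-- D • 𝓑 = Eₓ shows  D • σ𝓑 = E_{1-x} = D • 𝓑_{1-x};  as D is invertible, 𝓑_{1-x} = σ𝓑.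

σ : AF → AF
σ f k = scale (sgn k) (f k)

σ-cong : ∀ {f g} → f ≋ᶠ g → σ f ≋ᶠ σ g
σ-cong e = mk≋ᶠ λ k → scale-congʳ (sgn k) (atᶠ e k)

scale-neg : ∀ s p → scale (- s) p ≋ -1ₚ *ₚ scale s p
scale-neg s p = ≋-trans (scale-cong (neg-as-product s) (≋-refl {p}))
  (≋-trans (≋-sym (scale-scale (- 1ℚ) s p)) (scale-const (- 1ℚ) (scale s p)))
  where
  neg-as-product : ∀ s → - s ≡ (- 1ℚ) * s
  neg-as-product = solve-∀ ℚ-ring

∂σ : ∀ f → ∂ (σ f) ≋ᶠ -1ₚ ·ᶠ σ (∂ f)
∂σ f = mk≋ᶠ λ k → scale-neg (sgn k) (f (suc k))

σ-•-at : ∀ k f g → σ (f • g) k ≋ (σ f • σ g) k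
σ-•-at zero    f g = ≋-trans (scale-one ((f • g) 0)) (≋-trans (•-at-zero f g)
  (≋-sym (≋-trans (•-at-zero (σ f) (σ g)) (*ₚ-cong (scale-one (f 0)) (scale-one (g 0))))))
σ-•-at (suc k) f g = begin
  scale (- sgn k) ((f • g) (suc k))
    ≈⟨ scale-neg (sgn k) ((f • g) (suc k)) ⟩
  -1ₚ *ₚ scale (sgn k) ((f • g) (suc k))
    ≈⟨ *ₚ-congʳ -1ₚ (≋-trans (scale-congʳ (sgn k) (leibniz f g k)) (scale-+ₚ (sgn k) ((∂ f • g) k) ((f • ∂ g) k))) ⟩
  -1ₚ *ₚ (σ (∂ f • g) k +ₚ σ (f • ∂ g) k)
    ≈⟨ *ₚ-congʳ -1ₚ (+ₚ-cong (σ-•-at k (∂ f) g) (σ-•-at k f (∂ g))) ⟩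
  -1ₚ *ₚ ((σ (∂ f) • σ g) k +ₚ (σ f • σ (∂ g)) k)
    ≈⟨ *ₚ-distribˡ -1ₚ ((σ (∂ f) • σ g) k) ((σ f • σ (∂ g)) k) ⟩
  -1ₚ *ₚ (σ (∂ f) • σ g) k +ₚ -1ₚ *ₚ (σ f • σ (∂ g)) k
    ≈⟨ +ₚ-cong (≋-sym (·•-at k -1ₚ (σ (∂ f)) (σ g))) (≋-sym (atᶠ (•· -1ₚ (σ f) (σ (∂ g))) k)) ⟩
  ((-1ₚ ·ᶠ σ (∂ f)) • σ g) k +ₚ (σ f • (-1ₚ ·ᶠ σ (∂ g))) k
    ≈⟨ +ₚ-cong (•-cong-at k (≋ᶠ-sym (∂σ f)) (≋ᶠ-refl {σ g})) (•-cong-at k (≋ᶠ-refl {σ f}) (≋ᶠ-sym (∂σ g))) ⟩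
  (∂ (σ f) • σ g) k +ₚ (σ f • ∂ (σ g)) k
    ≈⟨ ≋-sym (leibniz (σ f) (σ g) k) ⟩
  (σ f • σ g) (suc k) ∎
  where open ≋-Reasoning

σ-• : ∀ f g → σ (f • g) ≋ᶠ σ f • σ g
σ-• f g = mk≋ᶠ λ k → σ-•-at k f g

σ-e : σ eAF ≋ᶠ eAF
σ-e = mk≋ᶠ λ { zero → scale-one oneₚ ; (suc k) → ≋-refl }

σ-powAF : ∀ f n → σ (powAF f n) ≋ᶠ powAF (σ f) n
σ-powAF f zero    = σ-e
σ-powAF f (suc n) = ≋ᶠ-trans (σ-• f (powAF f n)) (•-congʳ (σ f) (σ-powAF f n))

σ-E : ∀ a → σ (E a) ≋ᶠ E (-1ₚ *ₚ a)
σ-E a = mk≋ᶠ twisted-power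
  where
  twisted-power : ∀ k → scale (sgn k) (a ^ₚ k) ≋ (-1ₚ *ₚ a) ^ₚ k
  twisted-power zero    = scale-one oneₚ
  twisted-power (suc k) = begin
    scale (- sgn k) (a *ₚ (a ^ₚ k))        ≈⟨ scale-neg (sgn k) (a *ₚ (a ^ₚ k)) ⟩
    -1ₚ *ₚ scale (sgn k) (a *ₚ (a ^ₚ k))   ≈⟨ *ₚ-congʳ -1ₚ (≋-sym (*ₚ-scale (sgn k) a (a ^ₚ k))) ⟩
    -1ₚ *ₚ (a *ₚ scale (sgn k) (a ^ₚ k))   ≈⟨ *ₚ-congʳ -1ₚ (*ₚ-congʳ a (twisted-power k)) ⟩
    -1ₚ *ₚ (a *ₚ ((-1ₚ *ₚ a) ^ₚ k))        ≈⟨ ≋-sym (*ₚ-assoc -1ₚ a _) ⟩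
    (-1ₚ *ₚ a) ^ₚ suc k                    ∎
    where open ≋-Reasoning

τσ : ∀ f → τ (σ f) ≋ᶠ -1ₚ ·ᶠ σ (τ f)
τσ f = mk≋ᶠ λ { zero → ≋-sym (*ₚ-zeroʳ -1ₚ) ; (suc k) → at-suc k }
  where
  sign-swap : ∀ c s → c * s ≡ (- 1ℚ) * ((- s) * c)
  sign-swap = solve-∀ ℚ-ring
  at-suc : ∀ k → scale (ℕ→ℚ (suc k)) (scale (sgn k) (f k)) ≋ -1ₚ *ₚ scale (- sgn k) (scale (ℕ→ℚ (suc k)) (f k))
  at-suc k = begin
    scale c (scale s (f k))                  ≈⟨ scale-scale c s (f k) ⟩
    scale (c * s) (f k)                      ≈⟨ scale-cong (sign-swap c s) (≋-refl {f k}) ⟩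
    scale ((- 1ℚ) * ((- s) * c)) (f k)       ≈⟨ ≋-sym (scale-scale (- 1ℚ) ((- s) * c) (f k)) ⟩
    scale (- 1ℚ) (scale ((- s) * c) (f k))   ≈⟨ scale-congʳ (- 1ℚ) (≋-sym (scale-scale (- s) c (f k))) ⟩
    scale (- 1ℚ) (scale (- s) (scale c (f k)))
                                             ≈⟨ scale-const (- 1ℚ) (scale (- s) (scale c (f k))) ⟩
    -1ₚ *ₚ scale (- s) (scale c (f k))       ∎
    where
    open ≋-Reasoning
    c s : ℚ
    c = ℕ→ℚ (suc k)
    s = sgn k

-- V plays 1 - e^{-t}.
V : AF
V zero    = []
V (suc k) = constₚ (sgn k)

1+-1ₚ≈0 : oneₚ +ₚ -1ₚ ≋ []
1+-1ₚ≈0 = mk≋ λ { zero → ℚP.+-inverseʳ 1ℚ ; (suc i) → refl }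

-σU≈V : -1ₚ ·ᶠ σ U ≋ᶠ V
-σU≈V = mk≋ᶠ λ { zero → *ₚ-zeroʳ -1ₚ ; (suc k) → at-suc k }
  where
  double-neg : ∀ s → (- 1ℚ) * (- s) ≡ s
  double-neg = solve-∀ ℚ-ring
  at-suc : ∀ k → -1ₚ *ₚ scale (- sgn k) oneₚ ≋ constₚ (sgn k)
  at-suc k = ≋-trans (*ₚ-congʳ -1ₚ (≋-trans (scale-const (- sgn k) oneₚ) (*ₚ-identityʳ (constₚ (- sgn k)))))
    (≋-trans (≋-sym (const-* (- 1ℚ) (- sgn k))) (≡⇒≋ (cong constₚ (double-neg (sgn k)))))

E₋₁•U≈V : E -1ₚ • U ≋ᶠ V
E₋₁•U≈V = begin
  E -1ₚ • U                              ≈⟨ •-congʳ (E -1ₚ) U≈E₁-e ⟩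
  E -1ₚ • (E oneₚ ⊕ (⊖ eAF))             ≈⟨ •-distribˡ (E -1ₚ) (E oneₚ) (⊖ eAF) ⟩
  (E -1ₚ • E oneₚ) ⊕ (E -1ₚ • (⊖ eAF))
    ≈⟨ ⊕-cong (≋ᶠ-trans (E-+ -1ₚ oneₚ) (≋ᶠ-trans (E-cong (≋-trans (+ₚ-comm -1ₚ oneₚ) 1+-1ₚ≈0)) E-zero))
              (≋ᶠ-trans (•-congʳ (E -1ₚ) (mk≋ᶠ λ k → scale-const (- 1ℚ) (eAF k)))
              (≋ᶠ-trans (•· -1ₚ (E -1ₚ) eAF) (·ᶠ-congʳ -1ₚ (•e (E -1ₚ))))) ⟩
  eAF ⊕ (-1ₚ ·ᶠ E -1ₚ)                   ≈⟨ mk≋ᶠ pointwise ⟩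
  V                                      ∎
  where
  open ≋ᶠ-Reasoning
  double-neg : ∀ s → - (- s) ≡ s
  double-neg = solve-∀ ℚ-ring
  pointwise : ∀ k → (eAF ⊕ (-1ₚ ·ᶠ E -1ₚ)) k ≋ V k
  pointwise zero    = ≋-trans (+ₚ-congʳ oneₚ (*ₚ-identityʳ -1ₚ)) 1+-1ₚ≈0
  pointwise (suc k) = ≋-trans (-1ₚ-^ (suc (suc k))) (≡⇒≋ (cong constₚ (double-neg (sgn k))))

σD≈E₋₁•D : σ D ≋ᶠ E -1ₚ • D
σD≈E₋₁•D = τ-injective (≋ᶠ-trans (τσ D) (≋ᶠ-trans (·ᶠ-congʳ -1ₚ (σ-cong τD≈U)) (≋ᶠ-trans -σU≈V
  (≋ᶠ-sym (≋ᶠ-trans (τ-•ʳ (E -1ₚ) D) (≋ᶠ-trans (•-congʳ (E -1ₚ) τD≈U) E₋₁•U≈V))))))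

D-cancel : ∀ f g → D • f ≋ᶠ D • g → f ≋ᶠ g
D-cancel f g e = begin
  f                    ≈⟨ ≋ᶠ-sym (e• f) ⟩
  eAF • f              ≈⟨ •-congˡ (≋ᶠ-sym D⁻¹•D≈e) f ⟩
  (D⁻¹ • D) • f        ≈⟨ •-assoc D⁻¹ D f ⟩
  D⁻¹ • (D • f)        ≈⟨ •-congʳ D⁻¹ e ⟩
  D⁻¹ • (D • g)        ≈⟨ ≋ᶠ-sym (•-assoc D⁻¹ D g) ⟩
  (D⁻¹ • D) • g        ≈⟨ •-congˡ D⁻¹•D≈e g ⟩
  eAF • g              ≈⟨ e• g ⟩
  g                    ∎
  where
  open ≋ᶠ-Reasoning
  D⁻¹ : AF
  D⁻¹ = 𝓑 • E -x
  D⁻¹•D≈e : D⁻¹ • D ≋ᶠ eAF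
  D⁻¹•D≈e = ≋ᶠ-trans (•-comm D⁻¹ D) (≋ᶠ-trans (≋ᶠ-sym (•-assoc D 𝓑 (E -x)))
    (≋ᶠ-trans (•-congˡ D•𝓑≈Eₓ (E -x)) (≋ᶠ-trans (E-+ Xₚ -x) (≋ᶠ-trans (E-cong (negₚ-inverseʳ Xₚ)) E-zero))))

D•σ𝓑≈E₁₋ₓ : D • σ 𝓑 ≋ᶠ E 1-x
D•σ𝓑≈E₁₋ₓ = begin
  D • σ 𝓑                   ≈⟨ ≋ᶠ-sym (e• (D • σ 𝓑)) ⟩
  eAF • (D • σ 𝓑)           ≈⟨ •-congˡ (≋ᶠ-sym (≋ᶠ-trans (E-+ oneₚ -1ₚ) (≋ᶠ-trans (E-cong 1+-1ₚ≈0) E-zero))) (D • σ 𝓑) ⟩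
  (E oneₚ • E -1ₚ) • (D • σ 𝓑)
                            ≈⟨ •-assoc (E oneₚ) (E -1ₚ) (D • σ 𝓑) ⟩
  E oneₚ • (E -1ₚ • (D • σ 𝓑))
                            ≈⟨ •-congʳ (E oneₚ) twisted ⟩
  E oneₚ • E (-1ₚ *ₚ Xₚ)    ≈⟨ E-+ oneₚ (-1ₚ *ₚ Xₚ) ⟩
  E (oneₚ +ₚ -1ₚ *ₚ Xₚ)     ≈⟨ E-cong (+ₚ-congʳ oneₚ (≋-sym (scale-const (- 1ℚ) Xₚ))) ⟩
  E 1-x                     ∎
  where
  open ≋ᶠ-Reasoning
  twisted : E -1ₚ • (D • σ 𝓑) ≋ᶠ E (-1ₚ *ₚ Xₚ)
  twisted = ≋ᶠ-trans (≋ᶠ-sym (•-assoc (E -1ₚ) D (σ 𝓑))) (≋ᶠ-trans (•-congˡ (≋ᶠ-sym σD≈E₋₁•D) (σ 𝓑))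
    (≋ᶠ-trans (≋ᶠ-sym (σ-• D 𝓑)) (≋ᶠ-trans (σ-cong D•𝓑≈Eₓ) (σ-E Xₚ))))

reflect : Poly → Poly
reflect p = compₚ p 1-x

reflect-zero : ∀ p → p ≋ [] → reflect p ≋ []
reflect-zero []      e = ≋-refl
reflect-zero (a ∷ p) e = ≋-trans
  (+ₚ-cong (≋-trans (≡⇒≋ (cong constₚ (at e 0))) const-zero)
           (*ₚ-congʳ 1-x (reflect-zero p (mk≋ λ i → at e (suc i)))))
  (*ₚ-zeroʳ 1-x)

reflect-cong : ∀ p q → p ≋ q → reflect p ≋ reflect q
reflect-cong []      q       e = ≋-sym (reflect-zero q (≋-sym e))
reflect-cong (a ∷ p) []      e = reflect-zero (a ∷ p) e
reflect-cong (a ∷ p) (b ∷ q) e =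
  +ₚ-cong (≡⇒≋ (cong constₚ (at e 0))) (*ₚ-congʳ 1-x (reflect-cong p q (mk≋ λ i → at e (suc i))))

reflect-+ : ∀ p q → reflect (p +ₚ q) ≋ reflect p +ₚ reflect q
reflect-+ []      q       = ≋-refl
reflect-+ (a ∷ p) []      = ≋-sym (+ₚ-identityʳ (reflect (a ∷ p)))
reflect-+ (a ∷ p) (b ∷ q) = ≋-trans (+ₚ-congʳ (constₚ a +ₚ constₚ b) (*ₚ-congʳ 1-x (reflect-+ p q)))
  (regroup (constₚ a) (constₚ b) 1-x (reflect p) (reflect q))
  where
  regroup : ∀ A B c x y → (A +ₚ B) +ₚ c *ₚ (x +ₚ y) ≋ (A +ₚ c *ₚ x) +ₚ (B +ₚ c *ₚ y)
  regroup = solve-∀ Poly-ring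

reflect-scale : ∀ c p → reflect (scale c p) ≋ constₚ c *ₚ reflect p
reflect-scale c []      = ≋-sym (*ₚ-zeroʳ (constₚ c))
reflect-scale c (a ∷ p) = ≋-trans (+ₚ-cong (const-* c a) (*ₚ-congʳ 1-x (reflect-scale c p)))
  (factor (constₚ c) (constₚ a) 1-x (reflect p))
  where
  factor : ∀ C A d x → C *ₚ A +ₚ d *ₚ (C *ₚ x) ≋ C *ₚ (A +ₚ d *ₚ x)
  factor = solve-∀ Poly-ring

reflect-* : ∀ p q → reflect (p *ₚ q) ≋ reflect p *ₚ reflect q
reflect-* []      q = ≋-refl
reflect-* (a ∷ p) q = begin
  reflect (scale a q +ₚ (0ℚ ∷ (p *ₚ q)))
    ≈⟨ reflect-+ (scale a q) (0ℚ ∷ (p *ₚ q)) ⟩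
  reflect (scale a q) +ₚ (constₚ 0ℚ +ₚ 1-x *ₚ reflect (p *ₚ q))
    ≈⟨ +ₚ-cong (reflect-scale a q) (+ₚ-cong const-zero (*ₚ-congʳ 1-x (reflect-* p q))) ⟩
  constₚ a *ₚ reflect q +ₚ 1-x *ₚ (reflect p *ₚ reflect q)
    ≈⟨ factor (constₚ a) (reflect q) 1-x (reflect p) ⟩
  (constₚ a +ₚ 1-x *ₚ reflect p) *ₚ reflect q ∎
  where
  open ≋-Reasoning
  factor : ∀ A y c x → A *ₚ y +ₚ c *ₚ (x *ₚ y) ≋ (A +ₚ c *ₚ x) *ₚ y
  factor = solve-∀ Poly-ring

reflect-const : ∀ a → reflect (constₚ a) ≋ constₚ a
reflect-const a = ≋-trans (+ₚ-congʳ (constₚ a) (*ₚ-zeroʳ 1-x)) (+ₚ-identityʳ (constₚ a))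

reflect-x : reflect Xₚ ≋ 1-x
reflect-x = ≋-trans (+ₚ-cong const-zero (*ₚ-congʳ 1-x (reflect-const 1ℚ))) (*ₚ-identityʳ 1-x)

reflect-^ : ∀ a k → reflect (a ^ₚ k) ≋ reflect a ^ₚ k
reflect-^ a zero    = reflect-const 1ℚ
reflect-^ a (suc k) = ≋-trans (reflect-* a (a ^ₚ k)) (*ₚ-congʳ (reflect a) (reflect-^ a k))

reflect-sum : ∀ (h : ℕ → Poly) k → reflect (sumTo h k) ≋ sumTo (λ j → reflect (h j)) k
reflect-sum h zero    = ≋-refl
reflect-sum h (suc k) = ≋-trans (reflect-+ (sumTo h k) (h (suc k))) (+ₚ-congˡ (reflect-sum h k) _)

reflectᶠ : AF → AF
reflectᶠ f k = reflect (f k)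

reflectᶠ-• : ∀ f g → reflectᶠ (f • g) ≋ᶠ reflectᶠ f • reflectᶠ g
reflectᶠ-• f g = mk≋ᶠ λ k → ≋-trans (reflect-sum (λ m → scale (ℕ→ℚ (k C m)) (f m *ₚ g (k ∸ m))) k)
  (sum-cong k (λ m _ → ≋-trans (reflect-scale (ℕ→ℚ (k C m)) (f m *ₚ g (k ∸ m)))
    (≋-trans (*ₚ-congʳ (constₚ (ℕ→ℚ (k C m))) (reflect-* (f m) (g (k ∸ m))))
             (≋-sym (scale-const (ℕ→ℚ (k C m)) _)))))

D•𝓑₁₋≈E₁₋ₓ : D • 𝓑₁₋ ≋ᶠ E 1-x
D•𝓑₁₋≈E₁₋ₓ = begin
  D • 𝓑₁₋                  ≈⟨ •-congˡ (mk≋ᶠ λ k → ≋-sym (reflect-const (recip k))) 𝓑₁₋ ⟩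
  reflectᶠ D • reflectᶠ 𝓑   ≈⟨ ≋ᶠ-sym (reflectᶠ-• D 𝓑) ⟩
  reflectᶠ (D • 𝓑)          ≈⟨ mk≋ᶠ (λ k → reflect-cong _ _ (atᶠ D•𝓑≈Eₓ k)) ⟩
  reflectᶠ (E Xₚ)           ≈⟨ mk≋ᶠ (reflect-^ Xₚ) ⟩
  E (reflect Xₚ)            ≈⟨ E-cong reflect-x ⟩
  E 1-x                     ∎
  where open ≋ᶠ-Reasoning

𝓑₁₋≈σ𝓑 : 𝓑₁₋ ≋ᶠ σ 𝓑
𝓑₁₋≈σ𝓑 = D-cancel 𝓑₁₋ (σ 𝓑) (≋ᶠ-trans D•𝓑₁₋≈E₁₋ₓ (≋ᶠ-sym D•σ𝓑≈E₁₋ₓ))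

inverse-of-𝓑₁₋ⁿ : ∀ n g h → IsInverse (powAF 𝓑 n) g → IsInverse (powAF 𝓑₁₋ n) h → h ≋ᶠ σ g
inverse-of-𝓑₁₋ⁿ n g h g-inv h-inv = inverse-unique (powAF 𝓑₁₋ n) h (σ g)
  (inverse⇒≋ᶠ (powAF 𝓑₁₋ n) h h-inv)
  (begin
    powAF 𝓑₁₋ n • σ g      ≈⟨ •-congˡ (≋ᶠ-trans (powAF-cong n 𝓑₁₋≈σ𝓑) (≋ᶠ-sym (σ-powAF 𝓑 n))) (σ g) ⟩
    σ (powAF 𝓑 n) • σ g    ≈⟨ ≋ᶠ-sym (σ-• (powAF 𝓑 n) g) ⟩
    σ (powAF 𝓑 n • g)      ≈⟨ σ-cong (inverse⇒≋ᶠ (powAF 𝓑 n) g g-inv) ⟩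
    σ eAF                  ≈⟨ σ-e ⟩
    eAF                    ∎)
  where open ≋ᶠ-Reasoning

-- The derivative.  d/dx is a derivation of ℚ[x]; applied pointwise it is a
-- derivation of (AF, •), and it acts on P = D • E₋ₓ as  dP = -τP  (∂ₓ e^{-xt} = -t e^{-xt}).

coeff-derivFrom : ∀ j p i → coeff (derivFrom j p) i ≡ ℕ→ℚ (j +ℕ i) * coeff p i
coeff-derivFrom j []      i       = sym (ℚP.*-zeroʳ (ℕ→ℚ (j +ℕ i)))
coeff-derivFrom j (b ∷ r) zero    = cong (λ m → ℕ→ℚ m * b) (sym (ℕP.+-identityʳ j))
coeff-derivFrom j (b ∷ r) (suc i) =
  trans (coeff-derivFrom (suc j) r i) (cong (λ m → ℕ→ℚ m * coeff r i) (sym (ℕP.+-suc j i)))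

coeff-deriv : ∀ p i → coeff (derivₚ p) i ≡ ℕ→ℚ (suc i) * coeff p (suc i)
coeff-deriv []      i = sym (ℚP.*-zeroʳ (ℕ→ℚ (suc i)))
coeff-deriv (a ∷ p) i = coeff-derivFrom 1 p i

deriv-cong : ∀ {p q} → p ≋ q → derivₚ p ≋ derivₚ q
deriv-cong {p} {q} e = mk≋ λ i →
  trans (coeff-deriv p i) (trans (cong (ℕ→ℚ (suc i) *_) (at e (suc i))) (sym (coeff-deriv q i)))

deriv-+ : ∀ p q → derivₚ (p +ₚ q) ≋ derivₚ p +ₚ derivₚ q
deriv-+ p q = mk≋ λ i → trans (coeff-deriv (p +ₚ q) i)
  (trans (cong (ℕ→ℚ (suc i) *_) (coeff-+ p q (suc i)))
  (trans (ℚP.*-distribˡ-+ (ℕ→ℚ (suc i)) (coeff p (suc i)) (coeff q (suc i)))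
  (sym (trans (coeff-+ (derivₚ p) (derivₚ q) i) (cong₂ _+_ (coeff-deriv p i) (coeff-deriv q i))))))

deriv-scale : ∀ c p → derivₚ (scale c p) ≋ scale c (derivₚ p)
deriv-scale c p = mk≋ λ i → trans (coeff-deriv (scale c p) i)
  (trans (cong (ℕ→ℚ (suc i) *_) (coeff-scale c p (suc i)))
  (trans (swap (ℕ→ℚ (suc i)) c (coeff p (suc i)))
  (sym (trans (coeff-scale c (derivₚ p) i) (cong (c *_) (coeff-deriv p i))))))
  where
  swap : ∀ a b x → a * (b * x) ≡ b * (a * x)
  swap = solve-∀ ℚ-ring

cons-zero≈x* : ∀ s → 0ℚ ∷ s ≋ Xₚ *ₚ s
cons-zero≈x* s = mk≋ λ
  { zero    → sym (trans (coeff-*-zero Xₚ s) (ℚP.*-zeroˡ (coeff s 0)))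
  ; (suc i) → sym (trans (coeff-*-suc Xₚ s i)
                   (trans (cong₂ _+_ (ℚP.*-zeroˡ (coeff s (suc i))) (at (*ₚ-identityˡ s) i))
                          (ℚP.+-identityˡ (coeff s i)))) }

deriv-cons : ∀ a p → derivₚ (a ∷ p) ≋ p +ₚ Xₚ *ₚ derivₚ p
deriv-cons a p = mk≋ λ i →
  trans (coeff-deriv (a ∷ p) i) (sym (trans (coeff-+ p (Xₚ *ₚ derivₚ p) i) (at-index i)))
  where
  add-zero : ∀ y → y + 0ℚ ≡ 1ℚ * y
  add-zero = solve-∀ ℚ-ring
  add-multiple : ∀ y c → y + c * y ≡ (1ℚ + c) * y
  add-multiple = solve-∀ ℚ-ring
  at-index : ∀ i → coeff p i + coeff (Xₚ *ₚ derivₚ p) i ≡ ℕ→ℚ (suc i) * coeff p i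
  at-index zero    = trans (cong (λ y → coeff p 0 + y) (sym (at (cons-zero≈x* (derivₚ p)) 0)))
                           (add-zero (coeff p 0))
  at-index (suc i) = trans (cong (λ y → coeff p (suc i) + y)
                                 (trans (sym (at (cons-zero≈x* (derivₚ p)) (suc i))) (coeff-deriv p i)))
    (trans (add-multiple (coeff p (suc i)) (ℕ→ℚ (suc i))) (cong (_* coeff p (suc i)) (sym (ℕ→ℚ-suc (suc i)))))

deriv-* : ∀ p q → derivₚ (p *ₚ q) ≋ derivₚ p *ₚ q +ₚ p *ₚ derivₚ q
deriv-* []      q = ≋-refl
deriv-* (a ∷ p) q = begin
  derivₚ (scale a q +ₚ (0ℚ ∷ (p *ₚ q)))
    ≈⟨ deriv-+ (scale a q) (0ℚ ∷ (p *ₚ q)) ⟩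
  derivₚ (scale a q) +ₚ derivₚ (0ℚ ∷ (p *ₚ q))
    ≈⟨ +ₚ-cong (≋-trans (deriv-scale a q) (scale-const a (derivₚ q))) (deriv-cons 0ℚ (p *ₚ q)) ⟩
  constₚ a *ₚ derivₚ q +ₚ (p *ₚ q +ₚ Xₚ *ₚ derivₚ (p *ₚ q))
    ≈⟨ +ₚ-congʳ (constₚ a *ₚ derivₚ q) (+ₚ-congʳ (p *ₚ q) (*ₚ-congʳ Xₚ (deriv-* p q))) ⟩
  constₚ a *ₚ derivₚ q +ₚ (p *ₚ q +ₚ Xₚ *ₚ (derivₚ p *ₚ q +ₚ p *ₚ derivₚ q))
    ≈⟨ regroup (constₚ a) p q Xₚ (derivₚ p) (derivₚ q) ⟩
  (p +ₚ Xₚ *ₚ derivₚ p) *ₚ q +ₚ (constₚ a *ₚ derivₚ q +ₚ Xₚ *ₚ (p *ₚ derivₚ q))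
    ≈⟨ +ₚ-cong (*ₚ-congˡ (≋-sym (deriv-cons a p)) q)
               (+ₚ-cong (≋-sym (scale-const a (derivₚ q))) (≋-sym (cons-zero≈x* (p *ₚ derivₚ q)))) ⟩
  derivₚ (a ∷ p) *ₚ q +ₚ (a ∷ p) *ₚ derivₚ q ∎
  where
  open ≋-Reasoning
  regroup : ∀ A p q X dp dq →
    A *ₚ dq +ₚ (p *ₚ q +ₚ X *ₚ (dp *ₚ q +ₚ p *ₚ dq)) ≋ (p +ₚ X *ₚ dp) *ₚ q +ₚ (A *ₚ dq +ₚ X *ₚ (p *ₚ dq))
  regroup = solve-∀ Poly-ring

deriv-^ : ∀ a k → derivₚ (a ^ₚ suc k) ≋ scale (ℕ→ℚ (suc k)) (derivₚ a *ₚ a ^ₚ k)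
deriv-^ a zero    = ≋-trans (deriv-* a oneₚ)
  (≋-trans (+ₚ-congʳ (derivₚ a *ₚ oneₚ) (*ₚ-zeroʳ a))
  (≋-trans (+ₚ-identityʳ (derivₚ a *ₚ oneₚ)) (≋-sym (scale-one (derivₚ a *ₚ oneₚ)))))
deriv-^ a (suc k) = begin
  derivₚ (a *ₚ a ^ₚ suc k)
    ≈⟨ deriv-* a (a ^ₚ suc k) ⟩
  derivₚ a *ₚ a ^ₚ suc k +ₚ a *ₚ derivₚ (a ^ₚ suc k)
    ≈⟨ +ₚ-congʳ (derivₚ a *ₚ a ^ₚ suc k) (≋-trans (*ₚ-congʳ a (deriv-^ a k))
         (≋-trans (*ₚ-scale (ℕ→ℚ (suc k)) a (derivₚ a *ₚ a ^ₚ k))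
                  (scale-congʳ (ℕ→ℚ (suc k)) (swap a (derivₚ a) (a ^ₚ k))))) ⟩
  derivₚ a *ₚ a ^ₚ suc k +ₚ scale (ℕ→ℚ (suc k)) (derivₚ a *ₚ a ^ₚ suc k)
    ≈⟨ ≋-sym (scale-suc (suc k) (derivₚ a *ₚ a ^ₚ suc k)) ⟩
  scale (ℕ→ℚ (suc (suc k))) (derivₚ a *ₚ a ^ₚ suc k) ∎
  where
  open ≋-Reasoning
  swap : ∀ a b c → a *ₚ (b *ₚ c) ≋ b *ₚ (a *ₚ c)
  swap = solve-∀ Poly-ring

derivᶠ : AF → AF
derivᶠ f k = derivₚ (f k)

derivᶠ-•-at : ∀ k f g → derivₚ ((f • g) k) ≋ (derivᶠ f • g) k +ₚ (f • derivᶠ g) k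
derivᶠ-•-at zero    f g = ≋-trans (deriv-cong (•-at-zero f g))
  (≋-trans (deriv-* (f 0) (g 0)) (≋-sym (+ₚ-cong (•-at-zero (derivᶠ f) g) (•-at-zero f (derivᶠ g)))))
derivᶠ-•-at (suc k) f g = begin
  derivₚ ((f • g) (suc k))
    ≈⟨ ≋-trans (deriv-cong (leibniz f g k)) (deriv-+ ((∂ f • g) k) ((f • ∂ g) k)) ⟩
  derivₚ ((∂ f • g) k) +ₚ derivₚ ((f • ∂ g) k)
    ≈⟨ +ₚ-cong (derivᶠ-•-at k (∂ f) g) (derivᶠ-•-at k f (∂ g)) ⟩
  ((derivᶠ (∂ f) • g) k +ₚ (∂ f • derivᶠ g) k) +ₚ ((derivᶠ f • ∂ g) k +ₚ (f • derivᶠ (∂ g)) k)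
    ≈⟨ interchange ((derivᶠ (∂ f) • g) k) ((∂ f • derivᶠ g) k) ((derivᶠ f • ∂ g) k) ((f • derivᶠ (∂ g)) k) ⟩
  ((derivᶠ (∂ f) • g) k +ₚ (derivᶠ f • ∂ g) k) +ₚ ((∂ f • derivᶠ g) k +ₚ (f • derivᶠ (∂ g)) k)
    ≈⟨ ≋-sym (+ₚ-cong (leibniz (derivᶠ f) g k) (leibniz f (derivᶠ g) k)) ⟩
  (derivᶠ f • g) (suc k) +ₚ (f • derivᶠ g) (suc k) ∎
  where
  open ≋-Reasoning
  interchange : ∀ a b c d → (a +ₚ b) +ₚ (c +ₚ d) ≋ (a +ₚ c) +ₚ (b +ₚ d)
  interchange = solve-∀ Poly-ring

derivᶠ-• : ∀ f g → derivᶠ (f • g) ≋ᶠ (derivᶠ f • g) ⊕ (f • derivᶠ g)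
derivᶠ-• f g = mk≋ᶠ λ k → derivᶠ-•-at k f g

derivᶠ-powAF : ∀ f m → derivᶠ (powAF f (suc m)) ≋ᶠ constₚ (ℕ→ℚ (suc m)) ·ᶠ (powAF f m • derivᶠ f)
derivᶠ-powAF f zero = begin
  derivᶠ (f • eAF)                              ≈⟨ derivᶠ-• f eAF ⟩
  (derivᶠ f • eAF) ⊕ (f • derivᶠ eAF)
    ≈⟨ ⊕-cong (•e (derivᶠ f)) (≋ᶠ-trans (•-congʳ f derivᶠ-e) (≋ᶠ-trans (•-comm f 0ᶠ) (0ᶠ• f))) ⟩
  derivᶠ f ⊕ 0ᶠ                                 ≈⟨ mk≋ᶠ (λ k → +ₚ-identityʳ (derivᶠ f k)) ⟩
  derivᶠ f                                      ≈⟨ ≋ᶠ-sym (≋ᶠ-trans (·ᶠ-identity (eAF • derivᶠ f)) (e• (derivᶠ f))) ⟩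
  constₚ (ℕ→ℚ 1) ·ᶠ (eAF • derivᶠ f)            ∎
  where
  open ≋ᶠ-Reasoning
  derivᶠ-e : derivᶠ eAF ≋ᶠ 0ᶠ
  derivᶠ-e = mk≋ᶠ λ { zero → ≋-refl ; (suc k) → ≋-refl }
derivᶠ-powAF f (suc m) = begin
  derivᶠ (f • fᵐ⁺¹)
    ≈⟨ derivᶠ-• f fᵐ⁺¹ ⟩
  (derivᶠ f • fᵐ⁺¹) ⊕ (f • derivᶠ fᵐ⁺¹)
    ≈⟨ ⊕-cong (≋ᶠ-trans (•-comm (derivᶠ f) fᵐ⁺¹) (≋ᶠ-sym (·ᶠ-identity _)))
              (≋ᶠ-trans (•-congʳ f (derivᶠ-powAF f m))
              (≋ᶠ-trans (•· m+1 f (powAF f m • derivᶠ f))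
                        (·ᶠ-congʳ m+1 (≋ᶠ-sym (•-assoc f (powAF f m) (derivᶠ f)))))) ⟩
  (oneₚ ·ᶠ (fᵐ⁺¹ • derivᶠ f)) ⊕ (m+1 ·ᶠ (fᵐ⁺¹ • derivᶠ f))
    ≈⟨ ·ᶠ-distrib oneₚ m+1 (fᵐ⁺¹ • derivᶠ f) ⟩
  (oneₚ +ₚ m+1) ·ᶠ (fᵐ⁺¹ • derivᶠ f)
    ≈⟨ ·ᶠ-cong (≡⇒≋ (cong constₚ (sym (ℕ→ℚ-suc (suc m))))) (≋ᶠ-refl {fᵐ⁺¹ • derivᶠ f}) ⟩
  constₚ (ℕ→ℚ (suc (suc m))) ·ᶠ (fᵐ⁺¹ • derivᶠ f) ∎
  where
  open ≋ᶠ-Reasoning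
  fᵐ⁺¹ : AF
  fᵐ⁺¹ = powAF f (suc m)
  m+1 : Poly
  m+1 = constₚ (ℕ→ℚ (suc m))

derivᶠ-E₋ₓ : derivᶠ (E -x) ≋ᶠ -1ₚ ·ᶠ τ (E -x)
derivᶠ-E₋ₓ = mk≋ᶠ λ { zero → ≋-sym (*ₚ-zeroʳ -1ₚ) ; (suc k) → at-suc k }
  where
  deriv-x : derivₚ -x ≋ -1ₚ
  deriv-x = ≋-trans (deriv-scale (- 1ℚ) Xₚ) (≋-trans (scale-const (- 1ℚ) oneₚ) (*ₚ-identityʳ -1ₚ))
  at-suc : ∀ k → derivₚ (-x ^ₚ suc k) ≋ -1ₚ *ₚ scale (ℕ→ℚ (suc k)) (-x ^ₚ k)
  at-suc k = ≋-trans (deriv-^ -x k)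
    (≋-trans (scale-congʳ (ℕ→ℚ (suc k)) (*ₚ-congˡ deriv-x (-x ^ₚ k)))
             (≋-sym (*ₚ-scale (ℕ→ℚ (suc k)) -1ₚ (-x ^ₚ k))))

derivᶠ-P : derivᶠ P ≋ᶠ -1ₚ ·ᶠ τ P
derivᶠ-P = begin
  derivᶠ (D • E -x)                          ≈⟨ derivᶠ-• D (E -x) ⟩
  (derivᶠ D • E -x) ⊕ (D • derivᶠ (E -x))    ≈⟨ ⊕-cong (0ᶠ• (E -x)) (•-congʳ D derivᶠ-E₋ₓ) ⟩
  0ᶠ ⊕ (D • (-1ₚ ·ᶠ τ (E -x)))               ≈⟨ ≋ᶠ-refl ⟩
  D • (-1ₚ ·ᶠ τ (E -x))                      ≈⟨ •· -1ₚ D (τ (E -x)) ⟩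
  -1ₚ ·ᶠ (D • τ (E -x))                      ≈⟨ ·ᶠ-congʳ -1ₚ (≋ᶠ-sym (τ-•ʳ D (E -x))) ⟩
  -1ₚ ·ᶠ τ P                                 ∎
  where open ≋ᶠ-Reasoning

derivᶠ-Pⁿ : ∀ n k → 1 ≤ n → 1 ≤ k →
  derivₚ (powAF P n k) ≋ scale (- ℕ→ℚ (n *ℕ k)) (powAF P n (k ∸ 1))
derivᶠ-Pⁿ (suc m) (suc k) _ _ = begin
  derivₚ (Pⁿ (suc k))
    ≈⟨ atᶠ (derivᶠ-powAF P m) (suc k) ⟩
  (n' ·ᶠ (powAF P m • derivᶠ P)) (suc k)
    ≈⟨ atᶠ (·ᶠ-congʳ n' (≋ᶠ-trans (•-congʳ (powAF P m) derivᶠ-P) (•· -1ₚ (powAF P m) (τ P)))) (suc k) ⟩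
  (n' ·ᶠ (-1ₚ ·ᶠ (powAF P m • τ P))) (suc k)
    ≈⟨ atᶠ (≋ᶠ-trans (·ᶠ-assoc n' -1ₚ _) (·ᶠ-congʳ (n' *ₚ -1ₚ)
          (≋ᶠ-trans (≋ᶠ-sym (τ-•ʳ (powAF P m) P)) (τ-cong (•-comm (powAF P m) P))))) (suc k) ⟩
  (n' *ₚ -1ₚ) *ₚ scale (ℕ→ℚ (suc k)) (Pⁿ k)
    ≈⟨ ≋-trans (*ₚ-scale (ℕ→ℚ (suc k)) (n' *ₚ -1ₚ) (Pⁿ k))
               (≋-trans (scale-congʳ (ℕ→ℚ (suc k)) (*ₚ-congˡ (≋-sym (const-* (ℕ→ℚ (suc m)) (- 1ℚ))) (Pⁿ k)))
               (≋-trans (scale-congʳ (ℕ→ℚ (suc k)) (≋-sym (scale-const (ℕ→ℚ (suc m) * - 1ℚ) (Pⁿ k))))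
                        (scale-scale (ℕ→ℚ (suc k)) (ℕ→ℚ (suc m) * - 1ℚ) (Pⁿ k)))) ⟩
  scale (ℕ→ℚ (suc k) * (ℕ→ℚ (suc m) * - 1ℚ)) (Pⁿ k)
    ≈⟨ scale-cong (trans (sign (ℕ→ℚ (suc k)) (ℕ→ℚ (suc m))) (cong -_ (sym (ℕ→ℚ-* (suc m) (suc k)))))
                  (≋-refl {Pⁿ k}) ⟩
  scale (- ℕ→ℚ (suc m *ℕ suc k)) (Pⁿ k) ∎
  where
  open ≋-Reasoning
  Pⁿ : AF
  Pⁿ = powAF P (suc m)
  n' : Poly
  n' = constₚ (ℕ→ℚ (suc m))
  sign : ∀ a b → a * (b * - 1ℚ) ≡ - (b * a)
  sign = solve-∀ ℚ-ring

theorem3 : (n : ℕ) → 1 ≤ n →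
    Σ AF (λ g → IsInverse (powAF 𝓑 n) g)
    × ((g : AF) → IsInverse (powAF 𝓑 n) g →
         ((k : ℕ) → g k ≈ₚ invFormula n k)
         × ((h : AF) → IsInverse (powAF 𝓑₁₋ n) h →
              (k : ℕ) → h k ≈ₚ scale (sgn k) (g k))
         × ((k : ℕ) → 1 ≤ k →
              derivₚ (g k) ≈ₚ scale (- ℕ→ℚ (n *ℕ k)) (g (k ∸ 1))))
theorem3 n 1≤n =
  (powAF P n , λ k → at (atᶠ (𝓑ⁿ•Pⁿ≈e n) k)) ,
  λ g g-inv → formula g g-inv , symmetry g g-inv , derivative g g-inv
  where
  formula : ∀ g → IsInverse (powAF 𝓑 n) g → (k : ℕ) → g k ≈ₚ invFormula n k
  formula g g-inv k = at (≋-trans (atᶠ (inverse-of-𝓑ⁿ n g g-inv) k) (Pⁿ-formula n k))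

  symmetry : ∀ g → IsInverse (powAF 𝓑 n) g →
    (h : AF) → IsInverse (powAF 𝓑₁₋ n) h → (k : ℕ) → h k ≈ₚ scale (sgn k) (g k)
  symmetry g g-inv h h-inv k = at (atᶠ (inverse-of-𝓑₁₋ⁿ n g h g-inv h-inv) k)

  derivative : ∀ g → IsInverse (powAF 𝓑 n) g →
    (k : ℕ) → 1 ≤ k → derivₚ (g k) ≈ₚ scale (- ℕ→ℚ (n *ℕ k)) (g (k ∸ 1))
  derivative g g-inv k 1≤k = at (begin
    derivₚ (g k)                                  ≈⟨ deriv-cong (atᶠ g≈Pⁿ k) ⟩
    derivₚ (powAF P n k)                          ≈⟨ derivᶠ-Pⁿ n k 1≤n 1≤k ⟩
    scale (- ℕ→ℚ (n *ℕ k)) (powAF P n (k ∸ 1))    ≈⟨ scale-congʳ (- ℕ→ℚ (n *ℕ k)) (≋-sym (atᶠ g≈Pⁿ (k ∸ 1))) ⟩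
    scale (- ℕ→ℚ (n *ℕ k)) (g (k ∸ 1))            ∎)
    where
    open ≋-Reasoning
    g≈Pⁿ : g ≋ᶠ powAF P n
    g≈Pⁿ = inverse-of-𝓑ⁿ n g g-inv
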